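{- For any natural number $m\geqslant 1$ and any $n\geqslant 0$, there is a bijection between the set of maximal chains in the poset $\Sigma_n C_{m-1}^n$ obtained by stacking $C_{m-1}^0\to C_{m-1}^1\to\dots\to C_{m-1}^n$ and the set of $m$-partitions of a set with $mn$ elements. Consequently, the number of maximal chains in $\Sigma_n C_{m-1}^n$ is $\frac{(mn)!}{(m!)^n\, n!}$.
   Context: For $r\geqslant 0$, $C_r$ denotes the chain $\{0<1<\dots<r\}$, and $C_r^n$ its $n$-th cartesian power with the componentwise order. The maps $C_r^i\to C_r^{i+1}$ used for stacking are $(x_1,\dots,x_i)\mapsto(0,x_1,\dots,x_i)$. Stacking (lax sum): given posets $M_0,\dots,M_n$ and monotone maps $f_j\colon M_j\to M_{j+1}$, the poset $\Sigma_nM_n$ has elements the pairs $(x,j)$ with $0\leqslant j\leqslant n$, $x\in M_j$, ordered by $(x,j)\leqslant(y,k)$ iff $j\leqslant k$ and $(f_{k-1}\circ\dots\circ f_j)(x)\leqslant y$ in $M_k$ (identity composite when $j=k$). An $m$-partition of a set is a partition of it into blocks each of size exactly $m$. -}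

module Defs where

open import Level using (0ℓ)
open import Data.Bool using (Bool; true; false)
open import Data.Nat using (ℕ; zero; suc; _+_; _*_; _∸_; _^_; NonZero)
open import Data.Nat.Properties using (m*n≢0)
open import Data.Nat using (_!)
open import Data.Nat.DivMod using (_/_)
open import Data.Fin using (Fin; toℕ)
import Data.Fin as F
open import Data.Fin.Subset using (Subset; ∣_∣; _∈_)
open import Data.Vec using (Vec; _∷_; [])
open import Data.Vec.Relation.Binary.Pointwise.Inductive using (Pointwise)
open import Data.Product using (Σ; Σ-syntax; ∃-syntax; _×_; _,_; proj₁)
open import Data.Sum using (_⊎_)
open import Function using (it)
open import Relation.Binary.PropositionalEquality using (_≡_; refl; sym; trans; subst)
open import Relation.Binary.Bundles using (Setoid)
open import Relation.Binary.Structures using (IsEquivalence)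

-- The chain C_r = {0 < 1 < ... < r}, represented by Fin (suc r) with its
-- usual order; C_r^i is Vec (Fin (suc r)) i with the componentwise order.

C : ℕ → Set
C r = Fin (suc r)

Cpow : ℕ → ℕ → Set
Cpow r i = Vec (C r) i

_≤C_ : ∀ {r i} → Cpow r i → Cpow r i → Set
x ≤C y = Pointwise F._≤_ x y

ι : ∀ {r i} → Cpow r i → Cpow r (suc i)
ι x = F.zero ∷ x

ιs : ∀ {r i} (d : ℕ) → Cpow r i → Cpow r (d + i)
ιs zero x = x
ιs (suc d) x = ι (ιs d x)

-- The stacked poset  Σ_n C_r^n  (lax sum of C_r^0 → C_r^1 → … → C_r^n).
-- Elements: pairs (j , x) with 0 ≤ j ≤ n and x ∈ C_r^j.

Stack : (r n : ℕ) → Set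
Stack r n = Σ[ j ∈ Fin (suc n) ] Cpow r (toℕ j)

-- (j , x) ≤ (k , y)  iff  j ≤ k and (f_{k-1} ∘ … ∘ f_j)(x) ≤ y in C_r^k.
-- The condition "j ≤ k" is expressed by a d with d + j ≡ k; the composite
-- of the k - j stacking maps is ιs d.
_≼_ : ∀ {r n} → Stack r n → Stack r n → Set
_≼_ {r} (j , x) (k , y) =
  Σ[ d ∈ ℕ ] Σ[ e ∈ d + toℕ j ≡ toℕ k ] (subst (Cpow r) e (ιs d x) ≤C y)

IsChain : ∀ {r n} → (Stack r n → Bool) → Set
IsChain S = ∀ a b → S a ≡ true → S b ≡ true → (a ≼ b) ⊎ (b ≼ a)

IsMaximalChain : ∀ {r n} → (Stack r n → Bool) → Set
IsMaximalChain {r} {n} S =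
  IsChain S ×
  ((T : Stack r n → Bool) → IsChain T →
     (∀ a → S a ≡ true → T a ≡ true) → ∀ a → T a ≡ true → S a ≡ true)

MaxChains : (r n : ℕ) → Setoid 0ℓ 0ℓ
MaxChains r n = record
  { Carrier = Σ (Stack r n → Bool) IsMaximalChain
  ; _≈_ = λ S T → ∀ a → proj₁ S a ≡ proj₁ T a
  ; isEquivalence = record
    { refl = λ a → refl
    ; sym = λ p a → sym (p a)
    ; trans = λ p q a → trans (p a) (q a)
    }
  }

IsMPartition : (m N : ℕ) → (Subset N → Bool) → Set
IsMPartition m N P =
  (∀ B → P B ≡ true → ∣ B ∣ ≡ m) ×
  (∀ (i : Fin N) → ∃[ B ] (P B ≡ true × i ∈ B ×
      (∀ B′ → P B′ ≡ true → i ∈ B′ → B′ ≡ B)))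

MPartitions : (m N : ℕ) → Setoid 0ℓ 0ℓ
MPartitions m N = record
  { Carrier = Σ (Subset N → Bool) (IsMPartition m N)
  ; _≈_ = λ P Q → ∀ B → proj₁ P B ≡ proj₁ Q B
  ; isEquivalence = record
    { refl = λ a → refl
    ; sym = λ p a → sym (p a)
    ; trans = λ p q a → trans (p a) (q a)
    }
  }

!-nz : ∀ k → NonZero (k !)
!-nz zero = _
!-nz (suc k) = m*n≢0 (suc k) (k !) {{it}} {{ !-nz k }}

^-nz : ∀ a k → .{{NonZero a}} → NonZero (a ^ k)
^-nz a zero = _
^-nz a (suc k) = m*n≢0 a (a ^ k) {{it}} {{ ^-nz a k }}

denom : ℕ → ℕ → ℕ
denom m n = (m !) ^ n * n !

denom-nz : ∀ m n → NonZero (denom m n)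
denom-nz m n = m*n≢0 ((m !) ^ n) (n !) {{^-nz (m !) n {{ !-nz m}}}} {{ !-nz n}}

countMPartitions : ℕ → ℕ → ℕ
countMPartitions m n = ((m * n) !) / denom m n
  where instance _ = denom-nz m n

-- Write m = r + 1. The elements (j + 1, x ∷ʳ c) of Σ_{n+1} C_r^{n+1} form the product of
-- Σ_n C_r^n with the last coordinate c ∈ C_r, and (0, []) is a new bottom below them; the poset is
-- graded of length (n + 1) m. A maximal chain climbs one rank at a time, each step raising either
-- the last coordinate or the Σ_n C_r^n part, so it amounts to a maximal chain of Σ_n C_r^n together
-- with the r-subset of the r + n m steps that raise the last coordinate. Likewise an m-partition of
-- an (n + 1) m-set amounts to the r partners of a fixed element in its block, an r-subset of the
-- other r + n m elements, together with an m-partition of the n m elements outside that block.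
-- Both sets are therefore in bijection with Fin (∏_{j<n} C(r + j m, r)), and the product
-- telescopes to (n m)! / ((m!)^n n!).

module Submission where

open import Level using (0ℓ)
open import Defs using (Cpow; ιs; Stack; _≼_; MaxChains; IsMPartition; MPartitions; denom; denom-nz; countMPartitions)
open import Data.Bool using (Bool; true; false; not; _∧_; _∨_)
import Data.Bool as Bool
open import Data.Bool.Properties using (T-≡)
open import Data.Nat using (ℕ; zero; suc; _+_; _*_; _∸_; _^_; _≤_; _<_; z≤n; s≤s; _≤?_; _≡ᵇ_; _!)
import Data.Nat as ℕ
open import Data.Nat.Properties hiding (_≟_)
open import Algebra.Properties.CommutativeSemigroup +-commutativeSemigroup using (xy∙z≈xz∙y; x∙yz≈y∙xz)
open import Data.Nat.Combinatorics using (_C_; nCk+nC[k+1]≡[n+1]C[k+1]; nCk≡n!/k![n-k]!; k![n∸k]!∣n!)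
open import Data.Nat.DivMod using (_/_; m/n*n≡m; m*n/n≡m)
open import Data.Nat.Tactic.RingSolver using (solve-∀)
open import Data.Fin using (Fin; toℕ; fromℕ; fromℕ<)
import Data.Fin as F
import Data.Fin.Properties as F
open import Data.Fin.Properties using (+↔⊎; *↔×)
open import Data.Fin.Subset using (Subset; ∣_∣; ∁; _∩_; _∈_; _∉_) renaming (⊥ to ∅)
open import Data.Fin.Subset.Properties using (∣⊥∣≡0; ∉⊥; x∈p∩q⁺; x∈p∩q⁻; Empty-unique; ∣∁p∣≡n∸∣p∣)
open import Data.Vec using (Vec; []; _∷_; _∷ʳ_; tail; init; last; initLast; here; there)
open import Data.Vec.Properties using (init-∷ʳ; last-∷ʳ; ≡-dec)
open import Data.Vec.Relation.Binary.Pointwise.Inductive using (Pointwise; []; _∷_)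
open import Data.Product using (Σ; Σ-syntax; ∃; ∃-syntax; _×_; _,_; proj₁; proj₂)
open import Data.Product.Relation.Binary.Pointwise.NonDependent using (_×ₛ_) renaming (Pointwise-≡↔≡ to ×-Pointwise-≡↔≡)
open import Data.Product.Function.NonDependent.Setoid using (_×-inverse_)
open import Data.Sum using (_⊎_; inj₁; inj₂; swap) renaming (map to ⊎-map)
open import Data.Sum.Relation.Binary.Pointwise using (_⊎ₛ_; inj₁; inj₂) renaming (Pointwise-≡↔≡ to ⊎-Pointwise-≡↔≡)
open import Data.Sum.Function.Setoid using (_⊎-inverse_)
open import Data.Unit using (⊤; tt)
open import Data.Empty using (⊥; ⊥-elim)
open import Function using (case_of_)
open import Function.Bundles using (Inverse; Bijection; Equivalence; _↔_)
open import Function.Definitions using (Congruent)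
open import Function.Consequences.Setoid using (strictlyInverseˡ⇒inverseˡ; strictlyInverseʳ⇒inverseʳ)
open import Function.Construct.Composition using () renaming (inverse to infixr 9 _⨾_)
open import Function.Construct.Identity using (↔-id) renaming (inverse to ↔ₛ-id)
open import Function.Construct.Symmetry using (↔-sym) renaming (inverse to ↔ₛ-sym)
open import Function.Properties.Inverse using (Inverse⇒Bijection)
open import Relation.Binary.Bundles using (Setoid)
import Relation.Binary.Construct.On as On
open import Relation.Binary.PropositionalEquality
open import Relation.Binary.PropositionalEquality.Properties using (subst-subst-sym; subst-sym-subst)
open import Relation.Nullary using (Dec; yes; no; does; isYes; _×-dec_)
open import Relation.Nullary.Decidable using (dec-true; toWitness; fromWitness)

Bool-ext : ∀ {a b : Bool} → (a ≡ true → b ≡ true) → (b ≡ true → a ≡ true) → a ≡ b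
Bool-ext {false} {false} _ _ = refl
Bool-ext {false} {true} _ b⇒a = b⇒a refl
Bool-ext {true} {false} a⇒b _ = sym (a⇒b refl)
Bool-ext {true} {true} _ _ = refl

∧-true⁻ : ∀ {a b} → a ∧ b ≡ true → a ≡ true × b ≡ true
∧-true⁻ {true} {true} _ = refl , refl

∧-true⁺ : ∀ {a b} → a ≡ true → b ≡ true → a ∧ b ≡ true
∧-true⁺ refl refl = refl

does-true : ∀ {A : Set} (a? : Dec A) → does a? ≡ true → A
does-true (yes a) _ = a

module _ {A B : Setoid 0ℓ 0ℓ} where
  private
    module A = Setoid A
    module B = Setoid B

  mkInverse : (to : A.Carrier → B.Carrier) (from : B.Carrier → A.Carrier) →
              Congruent A._≈_ B._≈_ to → Congruent B._≈_ A._≈_ from →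
              (∀ y → to (from y) B.≈ y) → (∀ x → from (to x) A.≈ x) → Inverse A B
  mkInverse to from to-cong from-cong to∘from from∘to = record
    { to        = to
    ; from      = from
    ; to-cong   = to-cong
    ; from-cong = from-cong
    ; inverse   = strictlyInverseˡ⇒inverseˡ A B to-cong to∘from
                , strictlyInverseʳ⇒inverseʳ A B from-cong from∘to
    }

Fin-cong : ∀ {a b} → a ≡ b → Fin a ↔ Fin b
Fin-cong {a} e = subst (λ b → Fin a ↔ Fin b) e (↔-id (Fin a))

SubsetsOfSize : ℕ → ℕ → Setoid 0ℓ 0ℓ
SubsetsOfSize L k = On.setoid {B = Σ (Subset L) (λ p → ∣ p ∣ ≡ k)} (setoid (Subset L)) proj₁

subsetsOfSize↔⊎ : ∀ L k → Inverse (SubsetsOfSize (suc L) (suc k)) (SubsetsOfSize L k ⊎ₛ SubsetsOfSize L (suc k))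
subsetsOfSize↔⊎ L k = mkInverse to from to-cong from-cong to∘from from∘to
  where
  open Setoid (SubsetsOfSize (suc L) (suc k)) using () renaming (Carrier to A; _≈_ to _≈ᴬ_)
  open Setoid (SubsetsOfSize L k ⊎ₛ SubsetsOfSize L (suc k)) using () renaming (Carrier to B; _≈_ to _≈ᴮ_)
  to : A → B
  to (true ∷ p , e) = inj₁ (p , suc-injective e)
  to (false ∷ p , e) = inj₂ (p , e)
  from : B → A
  from (inj₁ (p , e)) = true ∷ p , cong suc e
  from (inj₂ (p , e)) = false ∷ p , e
  to-cong : Congruent _≈ᴬ_ _≈ᴮ_ to
  to-cong {true ∷ p , _} refl = inj₁ refl
  to-cong {false ∷ p , _} refl = inj₂ refl
  from-cong : Congruent _≈ᴮ_ _≈ᴬ_ from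
  from-cong (inj₁ refl) = refl
  from-cong (inj₂ refl) = refl
  to∘from : ∀ y → to (from y) ≈ᴮ y
  to∘from (inj₁ _) = inj₁ refl
  to∘from (inj₂ _) = inj₂ refl
  from∘to : ∀ x → from (to x) ≈ᴬ x
  from∘to (true ∷ p , _) = refl
  from∘to (false ∷ p , _) = refl

∣p∣≡0⇒p≡∅ : ∀ {L} {p : Subset L} → ∣ p ∣ ≡ 0 → p ≡ ∅
∣p∣≡0⇒p≡∅ {p = []} _ = refl
∣p∣≡0⇒p≡∅ {p = false ∷ p} e = cong (false ∷_) (∣p∣≡0⇒p≡∅ e)

uniqueSubset↔Fin1 : ∀ L k (p : Subset L) → ∣ p ∣ ≡ k → (∀ q → ∣ q ∣ ≡ k → q ≡ p) →
                    Inverse (SubsetsOfSize L k) (setoid (Fin 1))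
uniqueSubset↔Fin1 L k p ∣p∣≡k unique =
  mkInverse (λ _ → F.zero) (λ _ → p , ∣p∣≡k) (λ _ → refl) (λ _ → refl)
            (λ { F.zero → refl }) (λ (q , ∣q∣≡k) → sym (unique q ∣q∣≡k))

noSubset↔Fin0 : ∀ k → Inverse (SubsetsOfSize 0 (suc k)) (setoid (Fin 0))
noSubset↔Fin0 k = mkInverse (λ { ([] , ()) }) (λ ()) (λ { {[] , ()} }) (λ { {()} }) (λ ()) (λ { ([] , ()) })

subsetsOfSize↔Fin : ∀ L k → Inverse (SubsetsOfSize L k) (setoid (Fin (L C k)))
subsetsOfSize↔Fin zero zero = uniqueSubset↔Fin1 0 0 [] refl λ { [] _ → refl }
subsetsOfSize↔Fin zero (suc k) = noSubset↔Fin0 k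
subsetsOfSize↔Fin (suc L) zero = uniqueSubset↔Fin1 (suc L) 0 ∅ (∣⊥∣≡0 (suc L)) (λ q → ∣p∣≡0⇒p≡∅)
subsetsOfSize↔Fin (suc L) (suc k) =
  subsetsOfSize↔⊎ L k ⨾ (subsetsOfSize↔Fin L k ⊎-inverse subsetsOfSize↔Fin L (suc k))
  ⨾ ⊎-Pointwise-≡↔≡ _ _ ⨾ ↔-sym +↔⊎ ⨾ Fin-cong (nCk+nC[k+1]≡[n+1]C[k+1] L k)

nCk*[k!*[n∸k]!]≡n! : ∀ {n k} → k ≤ n → (n C k) * (k ! * (n ∸ k) !) ≡ n !
nCk*[k!*[n∸k]!]≡n! {n} {k} k≤n = begin
  (n C k) * (k ! * (n ∸ k) !)               ≡⟨ cong (_* (k ! * (n ∸ k) !)) (nCk≡n!/k![n-k]! k≤n) ⟩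
  n ! / (k ! * (n ∸ k) !) * (k ! * (n ∸ k) !) ≡⟨ m/n*n≡m (k![n∸k]!∣n! k≤n) ⟩
  n !                                     ∎
  where
  open ≡-Reasoning
  instance _ = k !* (n ∸ k) !≢0

[k+l]Ck*[k!*l!]≡[k+l]! : ∀ k l → ((k + l) C k) * (k ! * l !) ≡ (k + l) !
[k+l]Ck*[k!*l!]≡[k+l]! k l =
  subst (λ x → ((k + l) C k) * (k ! * x !) ≡ (k + l) !) (m+n∸m≡n k l) (nCk*[k!*[n∸k]!]≡n! (m≤m+n k l))

private
  rearrange : ∀ B X r r! p n n! →
    B * X * ((suc r * r!) * p * (suc n * n!)) ≡ B * (r! * (X * (p * n!))) * (suc n * suc r)
  rearrange = solve-∀

module _ (r : ℕ) where

  binomialProduct : ℕ → ℕ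
  binomialProduct zero = 1
  binomialProduct (suc n) = ((r + n * suc r) C r) * binomialProduct n

  binomialProduct*denom≡[n*m]! : ∀ n → binomialProduct n * denom (suc r) n ≡ (n * suc r) !
  binomialProduct*denom≡[n*m]! zero = refl
  -- m ! = m * r ! and (suc n * m) ! = (suc n * m) * (r + n * m) ! hold by computation.
  binomialProduct*denom≡[n*m]! (suc n) = begin
    B * X * (m! ^ suc n * suc n !)        ≡⟨ rearrange B X r (r !) (m! ^ n) n (n !) ⟩
    B * (r ! * (X * (m! ^ n * n !))) * (suc n * suc r)
        ≡⟨ cong (λ x → B * (r ! * x) * (suc n * suc r)) (binomialProduct*denom≡[n*m]! n) ⟩
    B * (r ! * (n * suc r) !) * (suc n * suc r)
        ≡⟨ cong (_* (suc n * suc r)) ([k+l]Ck*[k!*l!]≡[k+l]! r (n * suc r)) ⟩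
    (r + n * suc r) ! * (suc n * suc r)   ≡⟨ *-comm _ (suc n * suc r) ⟩
    (suc n * suc r) !                     ∎
    where
    open ≡-Reasoning
    B X m! : ℕ
    B = (r + n * suc r) C r
    X = binomialProduct n
    m! = suc r !

  counted-by-binomialProduct : (F : ℕ → Setoid 0ℓ 0ℓ) → Inverse (F 0) (setoid (Fin 1)) →
    (∀ n → Inverse (F (suc n)) (SubsetsOfSize (r + n * suc r) r ×ₛ F n)) →
    ∀ n → Inverse (F n) (setoid (Fin (binomialProduct n)))
  counted-by-binomialProduct F base step zero = base
  counted-by-binomialProduct F base step (suc n) =
    step n ⨾ (subsetsOfSize↔Fin (r + n * suc r) r ×-inverse counted-by-binomialProduct F base step n)
    ⨾ ×-Pointwise-≡↔≡ ⨾ ↔-sym *↔×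

  binomialProduct≡countMPartitions : ∀ n → binomialProduct n ≡ countMPartitions (suc r) n
  binomialProduct≡countMPartitions n = sym (begin
    (suc r * n) ! / denom (suc r) n    ≡⟨ cong (λ k → k ! / denom (suc r) n) (*-comm (suc r) n) ⟩
    (n * suc r) ! / denom (suc r) n    ≡⟨ cong (_/ denom (suc r) n) (binomialProduct*denom≡[n*m]! n) ⟨
    binomialProduct n * denom (suc r) n / denom (suc r) n ≡⟨ m*n/n≡m (binomialProduct n) (denom (suc r) n) ⟩
    binomialProduct n                ∎)
    where
    open ≡-Reasoning
    instance _ = denom-nz (suc r) n

module ChainsOf {A : Set} (_≤_ : A → A → Set) where

  IsChain : (A → Bool) → Set
  IsChain S = ∀ a b → S a ≡ true → S b ≡ true → (a ≤ b) ⊎ (b ≤ a)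

  IsMaximalChain : (A → Bool) → Set
  IsMaximalChain S =
    IsChain S ×
    ((T : A → Bool) → IsChain T → (∀ a → S a ≡ true → T a ≡ true) → ∀ a → T a ≡ true → S a ≡ true)

  MaximalChains : Setoid 0ℓ 0ℓ
  MaximalChains = record
    { Carrier = Σ (A → Bool) IsMaximalChain
    ; _≈_ = λ S T → ∀ a → proj₁ S a ≡ proj₁ T a
    ; isEquivalence = record
      { refl = λ a → refl
      ; sym = λ p a → sym (p a)
      ; trans = λ p q a → trans (p a) (q a)
      }
    }

private
  variable
    A B : Set
    _≤ᴬ_ : A → A → Set
    _≤ᴮ_ : B → B → Set

preimage-chain : (f : A → B) → (∀ {a a'} → f a ≤ᴮ f a' → a ≤ᴬ a') →
                 ∀ {S} → ChainsOf.IsChain _≤ᴮ_ S → ChainsOf.IsChain _≤ᴬ_ (λ a → S (f a))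
preimage-chain f f-reflects ch a a' Sa Sa' = ⊎-map f-reflects f-reflects (ch (f a) (f a') Sa Sa')

preimage-maximal : (f : A → B) (g : B → A) → (∀ a → g (f a) ≡ a) → (∀ b → f (g b) ≡ b) →
                   (∀ {a a'} → f a ≤ᴮ f a' → a ≤ᴬ a') → (∀ {b b'} → g b ≤ᴬ g b' → b ≤ᴮ b') →
                   ∀ {S} → ChainsOf.IsMaximalChain _≤ᴮ_ S → ChainsOf.IsMaximalChain _≤ᴬ_ (λ a → S (f a))
preimage-maximal f g g∘f f∘g f-reflects g-reflects {S} (ch , maximal) =
  preimage-chain f f-reflects ch , λ T chT S∘f⊆T a Ta →
    maximal (λ b → T (g b)) (preimage-chain g g-reflects chT)
            (λ b Sb → S∘f⊆T (g b) (subst (λ x → S x ≡ true) (sym (f∘g b)) Sb))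
            (f a) (subst (λ x → T x ≡ true) (sym (g∘f a)) Ta)

maximalChains↔ : (f : A → B) (g : B → A) → (∀ a → g (f a) ≡ a) → (∀ b → f (g b) ≡ b) →
                 (∀ {a a'} → f a ≤ᴮ f a' → a ≤ᴬ a') → (∀ {b b'} → g b ≤ᴬ g b' → b ≤ᴮ b') →
                 Inverse (ChainsOf.MaximalChains _≤ᴮ_) (ChainsOf.MaximalChains _≤ᴬ_)
maximalChains↔ f g g∘f f∘g f-reflects g-reflects = mkInverse
  (λ (S , Sm) → (λ a → S (f a)) , preimage-maximal f g g∘f f∘g f-reflects g-reflects Sm)
  (λ (T , Tm) → (λ b → T (g b)) , preimage-maximal g f f∘g g∘f g-reflects f-reflects Tm)
  (λ S≈S' a → S≈S' (f a)) (λ T≈T' b → T≈T' (g b))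
  (λ (T , _) a → cong T (g∘f a)) (λ (S , _) b → cong S (f∘g b))

prefixCount : ∀ {L} → Subset L → ℕ → ℕ
prefixCount v zero = 0
prefixCount [] (suc t) = 0
prefixCount (true ∷ v) (suc t) = suc (prefixCount v t)
prefixCount (false ∷ v) (suc t) = prefixCount v t

prefixCount-step : ∀ {L} (v : Subset L) t →
                   prefixCount v t ≤ prefixCount v (suc t) × prefixCount v (suc t) ≤ suc (prefixCount v t)
prefixCount-step [] zero = z≤n , z≤n
prefixCount-step (true ∷ _) zero = z≤n , s≤s z≤n
prefixCount-step (false ∷ _) zero = z≤n , z≤n
prefixCount-step [] (suc t) = z≤n , z≤n
prefixCount-step (true ∷ v) (suc t) with p , q ← prefixCount-step v t = s≤s p , s≤s q
prefixCount-step (false ∷ v) (suc t) = prefixCount-step v t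

prefixCount-mono : ∀ {L} (v : Subset L) {t t'} → t ≤ t' → prefixCount v t ≤ prefixCount v t'
prefixCount-mono v {t} {t'} t≤t' with m≤n⇒m<n∨m≡n t≤t'
... | inj₂ refl = ≤-refl
... | inj₁ (s≤s t≤t'') = ≤-trans (prefixCount-mono v t≤t'') (proj₁ (prefixCount-step v _))

prefixCount-lipschitz : ∀ {L} (v : Subset L) {t t'} → t ≤ t' → prefixCount v t' ≤ prefixCount v t + (t' ∸ t)
prefixCount-lipschitz v {t} {t'} t≤t' with m≤n⇒m<n∨m≡n t≤t'
... | inj₂ refl = m≤m+n (prefixCount v t) (t ∸ t)
... | inj₁ (s≤s {n = t''} t≤t'') = begin
  prefixCount v (suc t'')               ≤⟨ proj₂ (prefixCount-step v t'') ⟩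
  suc (prefixCount v t'')               ≤⟨ s≤s (prefixCount-lipschitz v t≤t'') ⟩
  suc (prefixCount v t + (t'' ∸ t))     ≡⟨ +-suc (prefixCount v t) (t'' ∸ t) ⟨
  prefixCount v t + suc (t'' ∸ t)       ≡⟨ cong (prefixCount v t +_) (+-∸-assoc 1 t≤t'') ⟨
  prefixCount v t + (suc t'' ∸ t)       ∎
  where open ≤-Reasoning

prefixCount≤ : ∀ {L} (v : Subset L) t → prefixCount v t ≤ t
prefixCount≤ v zero = z≤n
prefixCount≤ [] (suc t) = z≤n
prefixCount≤ (true ∷ v) (suc t) = s≤s (prefixCount≤ v t)
prefixCount≤ (false ∷ v) (suc t) = m≤n⇒m≤1+n (prefixCount≤ v t)

prefixCount-full : ∀ {L} (v : Subset L) → prefixCount v L ≡ ∣ v ∣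
prefixCount-full [] = refl
prefixCount-full (true ∷ v) = cong suc (prefixCount-full v)
prefixCount-full (false ∷ v) = prefixCount-full v

prefixCount≤∣v∣ : ∀ {L} (v : Subset L) t → prefixCount v t ≤ ∣ v ∣
prefixCount≤∣v∣ v zero = z≤n
prefixCount≤∣v∣ [] (suc t) = z≤n
prefixCount≤∣v∣ (true ∷ v) (suc t) = s≤s (prefixCount≤∣v∣ v t)
prefixCount≤∣v∣ (false ∷ v) (suc t) = prefixCount≤∣v∣ v t

∣v∣≤prefixCount+rest : ∀ {L} (v : Subset L) t → ∣ v ∣ ≤ prefixCount v t + (L ∸ t)
∣v∣≤prefixCount+rest {L} v zero = subst (_≤ L) (prefixCount-full v) (prefixCount≤ v L)
∣v∣≤prefixCount+rest [] (suc t) = z≤n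
∣v∣≤prefixCount+rest (true ∷ v) (suc t) = s≤s (∣v∣≤prefixCount+rest v t)
∣v∣≤prefixCount+rest (false ∷ v) (suc t) = ∣v∣≤prefixCount+rest v t

_≢ᵇ_ : ℕ → ℕ → Bool
a ≢ᵇ b = not (a ≡ᵇ b)

n≢ᵇn : ∀ n → (n ≢ᵇ n) ≡ false
n≢ᵇn zero = refl
n≢ᵇn (suc n) = n≢ᵇn n

1+n≢ᵇn : ∀ n → (suc n ≢ᵇ n) ≡ true
1+n≢ᵇn zero = refl
1+n≢ᵇn (suc n) = 1+n≢ᵇn n

increments : (ℕ → ℕ) → (N : ℕ) → Subset N
increments g zero = []
increments g (suc N) = (g 1 ≢ᵇ g 0) ∷ increments (λ t → g (suc t)) N

UnitSteps : (ℕ → ℕ) → ℕ → Set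
UnitSteps g N = ∀ t → t < N → (g (suc t) ≡ g t) ⊎ (g (suc t) ≡ suc (g t))

prefixCount-increments : ∀ N g → UnitSteps g N → ∀ t → t ≤ N → prefixCount (increments g N) t + g 0 ≡ g t
prefixCount-increments N g steps zero _ = refl
prefixCount-increments (suc N) g steps (suc t) (s≤s t≤N) =
  trans (first-step (steps 0 (s≤s z≤n)))
        (prefixCount-increments N (λ t → g (suc t)) (λ t t<N → steps (suc t) (s≤s t<N)) t t≤N)
  where
  first-step : (g 1 ≡ g 0) ⊎ (g 1 ≡ suc (g 0)) →
               prefixCount (increments g (suc N)) (suc t) + g 0 ≡ prefixCount (increments (λ t → g (suc t)) N) t + g 1
  first-step (inj₁ g1≡g0) rewrite g1≡g0 | n≢ᵇn (g 0) = refl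
  first-step (inj₂ g1≡1+g0) rewrite g1≡1+g0 | 1+n≢ᵇn (g 0) = sym (+-suc _ (g 0))

increments-cong : ∀ N {g g'} → (∀ t → t ≤ N → g t ≡ g' t) → increments g N ≡ increments g' N
increments-cong zero _ = refl
increments-cong (suc N) g≗g' =
  cong₂ _∷_ (cong₂ _≢ᵇ_ (g≗g' 1 (s≤s z≤n)) (g≗g' 0 z≤n))
            (increments-cong N (λ t t≤N → g≗g' (suc t) (s≤s t≤N)))

increments-suc : ∀ N g → increments (λ t → suc (g t)) N ≡ increments g N
increments-suc zero g = refl
increments-suc (suc N) g = cong ((g 1 ≢ᵇ g 0) ∷_) (increments-suc N (λ t → g (suc t)))

increments-prefixCount : ∀ {N} (v : Subset N) → increments (prefixCount v) N ≡ v
increments-prefixCount [] = refl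
increments-prefixCount (true ∷ v) = cong (true ∷_) (trans (increments-suc _ (prefixCount v)) (increments-prefixCount v))
increments-prefixCount (false ∷ v) = cong (false ∷_) (increments-prefixCount v)

intermediate-value : ∀ N (f : ℕ → ℕ) → f 0 ≡ 0 → (∀ t → t < N → f (suc t) ≤ suc (f t)) →
                     ∀ i → i ≤ f N → Σ[ t ∈ ℕ ] (t ≤ N × f t ≡ i)
intermediate-value zero f f0≡0 _ i i≤f0 = 0 , z≤n , trans f0≡0 (sym (n≤0⇒n≡0 (subst (i ≤_) f0≡0 i≤f0)))
intermediate-value (suc N) f f0≡0 steps i i≤ with i ≤? f N
... | yes i≤fN with t , t≤N , ft≡i ← intermediate-value N f f0≡0 (λ t t<N → steps t (m≤n⇒m≤1+n t<N)) i i≤fN =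
  t , m≤n⇒m≤1+n t≤N , ft≡i
... | no i≰fN = suc N , ≤-refl , ≤-antisym (≤-trans (steps N ≤-refl) (≰⇒> i≰fN)) i≤

spread : ∀ {L} (v : Subset L) → Subset ∣ ∁ v ∣ → Subset L
spread [] [] = []
spread (true ∷ v) C = false ∷ spread v C
spread (false ∷ v) (c ∷ C) = c ∷ spread v C

restrict : ∀ {L} (v : Subset L) → Subset L → Subset ∣ ∁ v ∣
restrict [] [] = []
restrict (true ∷ v) (_ ∷ B) = restrict v B
restrict (false ∷ v) (b ∷ B) = b ∷ restrict v B

hole : ∀ {L} (v : Subset L) → Fin ∣ ∁ v ∣ → Fin L
hole (true ∷ v) i = F.suc (hole v i)
hole (false ∷ v) F.zero = F.zero
hole (false ∷ v) (F.suc i) = F.suc (hole v i)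

restrict-spread : ∀ {L} (v : Subset L) C → restrict v (spread v C) ≡ C
restrict-spread [] [] = refl
restrict-spread (true ∷ v) C = restrict-spread v C
restrict-spread (false ∷ v) (c ∷ C) = cong (c ∷_) (restrict-spread v C)

spread-restrict : ∀ {L} (v B : Subset L) → v ∩ B ≡ ∅ → spread v (restrict v B) ≡ B
spread-restrict [] [] _ = refl
spread-restrict (true ∷ v) (false ∷ B) v∩B≡∅ = cong (false ∷_) (spread-restrict v B (cong tail v∩B≡∅))
spread-restrict (false ∷ v) (b ∷ B) v∩B≡∅ = cong (b ∷_) (spread-restrict v B (cong tail v∩B≡∅))

spread-disjoint : ∀ {L} (v : Subset L) C → v ∩ spread v C ≡ ∅
spread-disjoint [] [] = refl
spread-disjoint (true ∷ v) C = cong (false ∷_) (spread-disjoint v C)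
spread-disjoint (false ∷ v) (c ∷ C) = cong (false ∷_) (spread-disjoint v C)

∣spread∣ : ∀ {L} (v : Subset L) C → ∣ spread v C ∣ ≡ ∣ C ∣
∣spread∣ [] [] = refl
∣spread∣ (true ∷ v) C = ∣spread∣ v C
∣spread∣ (false ∷ v) (true ∷ C) = cong suc (∣spread∣ v C)
∣spread∣ (false ∷ v) (false ∷ C) = ∣spread∣ v C

∣restrict∣ : ∀ {L} (v B : Subset L) → v ∩ B ≡ ∅ → ∣ restrict v B ∣ ≡ ∣ B ∣
∣restrict∣ [] [] _ = refl
∣restrict∣ (true ∷ v) (false ∷ B) v∩B≡∅ = ∣restrict∣ v B (cong tail v∩B≡∅)
∣restrict∣ (false ∷ v) (true ∷ B) v∩B≡∅ = cong suc (∣restrict∣ v B (cong tail v∩B≡∅))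
∣restrict∣ (false ∷ v) (false ∷ B) v∩B≡∅ = ∣restrict∣ v B (cong tail v∩B≡∅)

hole∈spread : ∀ {L} (v : Subset L) {C i} → i ∈ C → hole v i ∈ spread v C
hole∈spread (true ∷ v) i∈C = there (hole∈spread v i∈C)
hole∈spread (false ∷ v) {_ ∷ _} here = here
hole∈spread (false ∷ v) {_ ∷ _} (there i∈C) = there (hole∈spread v i∈C)

hole∈⇒∈restrict : ∀ {L} (v : Subset L) {B i} → hole v i ∈ B → i ∈ restrict v B
hole∈⇒∈restrict (true ∷ v) {_ ∷ _} (there h) = hole∈⇒∈restrict v h
hole∈⇒∈restrict (false ∷ v) {_ ∷ _} {F.zero} here = here
hole∈⇒∈restrict (false ∷ v) {_ ∷ _} {F.suc i} (there h) = there (hole∈⇒∈restrict v h)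

hole∉ : ∀ {L} (v : Subset L) i → hole v i ∉ v
hole∉ (true ∷ v) i (there h) = hole∉ v i h
hole∉ (false ∷ v) (F.suc i) (there h) = hole∉ v i h

∈⊎hole : ∀ {L} (v : Subset L) p → p ∈ v ⊎ Σ[ i ∈ Fin ∣ ∁ v ∣ ] hole v i ≡ p
∈⊎hole (true ∷ v) F.zero = inj₁ here
∈⊎hole (false ∷ v) F.zero = inj₂ (F.zero , refl)
∈⊎hole (true ∷ v) (F.suc p) with ∈⊎hole v p
... | inj₁ p∈v = inj₁ (there p∈v)
... | inj₂ (i , refl) = inj₂ (i , refl)
∈⊎hole (false ∷ v) (F.suc p) with ∈⊎hole v p
... | inj₁ p∈v = inj₁ (there p∈v)
... | inj₂ (i , refl) = inj₂ (F.suc i , refl)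

disjoint⁻ : ∀ {L} {v B : Subset L} {p} → v ∩ B ≡ ∅ → p ∈ v → p ∉ B
disjoint⁻ {p = p} v∩B≡∅ p∈v p∈B = ∉⊥ (subst (p ∈_) v∩B≡∅ (x∈p∩q⁺ (p∈v , p∈B)))

disjoint⁺ : ∀ {L} (v B : Subset L) → (∀ {p} → p ∈ v → p ∉ B) → v ∩ B ≡ ∅
disjoint⁺ v B disjoint = Empty-unique λ (p , p∈v∩B) → let p∈v , p∈B = x∈p∩q⁻ v B p∈v∩B in disjoint p∈v p∈B

module _ {A B : Set} {R : A → B → Set} where

  Pointwise-∷ʳ⁺ : ∀ {a b} {xs : Vec A a} {ys : Vec B b} {x y} →
                  Pointwise R xs ys → R x y → Pointwise R (xs ∷ʳ x) (ys ∷ʳ y)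
  Pointwise-∷ʳ⁺ [] x∼y = x∼y ∷ []
  Pointwise-∷ʳ⁺ (x∼y ∷ xs∼ys) x'∼y' = x∼y ∷ Pointwise-∷ʳ⁺ xs∼ys x'∼y'

  Pointwise-∷ʳ⁻ : ∀ {a b} (xs : Vec A a) (ys : Vec B b) {x y} →
                  Pointwise R (xs ∷ʳ x) (ys ∷ʳ y) → Pointwise R xs ys × R x y
  Pointwise-∷ʳ⁻ [] [] (x∼y ∷ []) = [] , x∼y
  Pointwise-∷ʳ⁻ [] (_ ∷ []) (_ ∷ ())
  Pointwise-∷ʳ⁻ [] (_ ∷ _ ∷ _) (_ ∷ ())
  Pointwise-∷ʳ⁻ (_ ∷ []) [] (_ ∷ ())
  Pointwise-∷ʳ⁻ (_ ∷ _ ∷ _) [] (_ ∷ ())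
  Pointwise-∷ʳ⁻ (x ∷ xs) (y ∷ ys) (x∼y ∷ rest) with xs∼ys , x'∼y' ← Pointwise-∷ʳ⁻ xs ys rest =
    x∼y ∷ xs∼ys , x'∼y'

module Tower (r : ℕ) where

  infixl 5 _▸_
  infix 4 _⊑_

  -- Σ_n C_r^n built from its last coordinate: bot is (0, []) and q ▸ c is (j + 1, x ∷ʳ c) for q = (j, x).
  data Tower : ℕ → Set where
    bot : ∀ {n} → Tower n
    _▸_ : ∀ {n} → Tower n → Fin (suc r) → Tower (suc n)

  _⊑_ : ∀ {n} → Tower n → Tower n → Set
  bot ⊑ _ = ⊤
  (q ▸ c) ⊑ bot = ⊥
  (q ▸ c) ⊑ (q' ▸ c') = q ⊑ q' × c F.≤ c'

  rank : ∀ {n} → Tower n → ℕ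
  rank bot = 0
  rank (q ▸ c) = suc (toℕ c + rank q)

  top : ∀ {n} → Tower n
  top {zero} = bot
  top {suc n} = top ▸ fromℕ r

  ⊑-refl : ∀ {n} (a : Tower n) → a ⊑ a
  ⊑-refl bot = tt
  ⊑-refl (q ▸ c) = ⊑-refl q , F.≤-refl

  ⊑-trans : ∀ {n} {a b c : Tower n} → a ⊑ b → b ⊑ c → a ⊑ c
  ⊑-trans {a = bot} _ _ = tt
  ⊑-trans {a = _ ▸ _} {_ ▸ _} {_ ▸ _} (q⊑q' , c≤c') (q'⊑q'' , c'≤c'') =
    ⊑-trans q⊑q' q'⊑q'' , F.≤-trans c≤c' c'≤c''

  ⊑top : ∀ {n} (a : Tower n) → a ⊑ top
  ⊑top bot = tt
  ⊑top (q ▸ c) = ⊑top q , F.≤fromℕ c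

  rank-top : ∀ n → rank (top {n}) ≡ n * suc r
  rank-top zero = refl
  rank-top (suc n) = cong suc (cong₂ _+_ (F.toℕ-fromℕ r) (rank-top n))

  rank-mono : ∀ {n} {a b : Tower n} → a ⊑ b → rank a ≤ rank b
  rank-mono {a = bot} _ = z≤n
  rank-mono {a = _ ▸ _} {_ ▸ _} (q⊑q' , c≤c') = s≤s (+-mono-≤ c≤c' (rank-mono q⊑q'))

  rank≤ : ∀ {n} (a : Tower n) → rank a ≤ n * suc r
  rank≤ {n} a = subst (rank a ≤_) (rank-top n) (rank-mono (⊑top a))

  private
    equal-summands : ∀ {a b c d} → a ≤ b → c ≤ d → a + c ≡ b + d → a ≡ b × c ≡ d
    equal-summands {a} a≤b c≤d e with m≤n⇒m<n∨m≡n a≤b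
    ... | inj₂ refl = refl , +-cancelˡ-≡ a _ _ e
    ... | inj₁ a<b = ⊥-elim (<⇒≢ (+-mono-<-≤ a<b c≤d) e)

  ⊑-rank-injective : ∀ {n} {a b : Tower n} → a ⊑ b → rank a ≡ rank b → a ≡ b
  ⊑-rank-injective {a = bot} {bot} _ _ = refl
  ⊑-rank-injective {a = q ▸ c} {q' ▸ c'} (q⊑q' , c≤c') e
    with c≡c' , rq≡rq' ← equal-summands c≤c' (rank-mono q⊑q') (suc-injective e) =
    cong₂ _▸_ (⊑-rank-injective q⊑q' rq≡rq') (F.toℕ-injective c≡c')

  ▸-injective : ∀ {n} {q q' : Tower n} {c c'} → q ▸ c ≡ q' ▸ c' → q ≡ q' × c ≡ c'
  ▸-injective refl = refl , refl

  _≟_ : ∀ {n} (a b : Tower n) → Dec (a ≡ b)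
  bot ≟ bot = yes refl
  bot ≟ (_ ▸ _) = no λ ()
  (_ ▸ _) ≟ bot = no λ ()
  (q ▸ c) ≟ (q' ▸ c') with q ≟ q' | c F.≟ c'
  ... | yes refl | yes refl = yes refl
  ... | no q≢q' | _ = no λ e → q≢q' (proj₁ (▸-injective e))
  ... | _ | no c≢c' = no λ e → c≢c' (proj₂ (▸-injective e))

  any? : ∀ {n} (P : Tower n → Set) → (∀ a → Dec (P a)) → Dec (∃ P)
  any? P P? with P? bot
  ... | yes p = yes (bot , p)
  any? {zero} P P? | no ¬p = no λ { (bot , p) → ¬p p }
  any? {suc n} P P? | no ¬p with any? (λ q → ∃ λ c → P (q ▸ c)) (λ q → F.any? (λ c → P? (q ▸ c)))
  ... | yes (q , c , p) = yes (q ▸ c , p)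
  ... | no ¬q = no λ { (bot , p) → ¬p p ; (q ▸ c , p) → ¬q (q , c , p) }

  Between : ∀ {n} → Tower n → Tower n → ℕ → Set
  Between {n} a b k = Σ[ c ∈ Tower n ] (a ⊑ c × c ⊑ b × rank c ≡ k)

  interpolate : ∀ {n} {a b : Tower n} → a ⊑ b → ∀ k → rank a ≤ k → k ≤ rank b → Between a b k
  interpolate▸ : ∀ {n} {q₁ q₂ : Tower n} {c₁ c₂} → q₁ ⊑ q₂ → c₁ F.≤ c₂ → ∀ k →
                 toℕ c₁ + rank q₁ ≤ k → k ≤ toℕ c₂ + rank q₂ → Between (q₁ ▸ c₁) (q₂ ▸ c₂) (suc k)

  interpolate {a = bot} _ zero _ _ = bot , tt , tt , refl
  interpolate {a = bot} {q ▸ c} _ (suc k) _ (s≤s k≤)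
    with x , _ , x⊑b , rx ← interpolate▸ {q₁ = bot} tt z≤n k z≤n k≤ =
    x , tt , x⊑b , rx
  interpolate {a = _ ▸ _} {_ ▸ _} (q₁⊑q₂ , c₁≤c₂) (suc k) (s≤s ≤k) (s≤s k≤) =
    interpolate▸ q₁⊑q₂ c₁≤c₂ k ≤k k≤

  -- Raise the Tower n part towards q₂ keeping c₁, and only once q₂ is reached the last coordinate.
  interpolate▸ {q₁ = q₁} {q₂} {c₁} {c₂} q₁⊑q₂ c₁≤c₂ k ≤k k≤ with k ≤? toℕ c₁ + rank q₂
  ... | yes k≤c₁+rq₂
    with y , q₁⊑y , y⊑q₂ , ry ← interpolate q₁⊑q₂ (k ∸ toℕ c₁)
           (m+n≤o⇒m≤o∸n (rank q₁) (subst (_≤ k) (+-comm (toℕ c₁) (rank q₁)) ≤k))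
           (m≤n+o⇒m∸n≤o k (toℕ c₁) k≤c₁+rq₂) =
    y ▸ c₁ , (q₁⊑y , F.≤-refl) , (y⊑q₂ , c₁≤c₂) ,
    cong suc (trans (cong (toℕ c₁ +_) ry) (m+[n∸m]≡n (≤-trans (m≤m+n (toℕ c₁) (rank q₁)) ≤k)))
  ... | no k≰c₁+rq₂ = q₂ ▸ d , (q₁⊑q₂ , c₁≤d) , (⊑-refl q₂ , d≤c₂) , cong suc rank≡k
    where
    c₁+rq₂<k : toℕ c₁ + rank q₂ < k
    c₁+rq₂<k = ≰⇒> k≰c₁+rq₂
    k∸rq₂≤c₂ : k ∸ rank q₂ ≤ toℕ c₂
    k∸rq₂≤c₂ = m≤n+o⇒m∸n≤o k (rank q₂) (subst (k ≤_) (+-comm (toℕ c₂) (rank q₂)) k≤)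
    d : Fin (suc r)
    d = fromℕ< (s≤s (≤-trans k∸rq₂≤c₂ (F.toℕ≤pred[n] c₂)))
    toℕd : toℕ d ≡ k ∸ rank q₂
    toℕd = F.toℕ-fromℕ< _
    c₁≤d : c₁ F.≤ d
    c₁≤d = subst (toℕ c₁ ≤_) (sym toℕd) (m+n≤o⇒m≤o∸n (toℕ c₁) (<⇒≤ c₁+rq₂<k))
    d≤c₂ : d F.≤ c₂
    d≤c₂ = subst (_≤ toℕ c₂) (sym toℕd) k∸rq₂≤c₂
    rank≡k : toℕ d + rank q₂ ≡ k
    rank≡k = trans (cong (_+ rank q₂) toℕd) (m∸n+n≡m (≤-trans (m≤n+m (rank q₂) (toℕ c₁)) (<⇒≤ c₁+rq₂<k)))

  module _ {n : ℕ} where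
    open ChainsOf (_⊑_ {n}) public

    RankIn : (Tower n → Bool) → ℕ → Set
    RankIn S k = Σ[ e ∈ Tower n ] (S e ≡ true × rank e ≡ k)

    HasEveryRank : (Tower n → Bool) → Set
    HasEveryRank S = ∀ k → k ≤ n * suc r → RankIn S k

    chain-rank-injective : ∀ {S} → IsChain S → ∀ {a b} → S a ≡ true → S b ≡ true → rank a ≡ rank b → a ≡ b
    chain-rank-injective ch {a} {b} Sa Sb e with ch a b Sa Sb
    ... | inj₁ a⊑b = ⊑-rank-injective a⊑b e
    ... | inj₂ b⊑a = sym (⊑-rank-injective b⊑a (sym e))

    chain-rank-≤⇒⊑ : ∀ {S} → IsChain S → ∀ {a b} → S a ≡ true → S b ≡ true → rank a ≤ rank b → a ⊑ b
    chain-rank-≤⇒⊑ ch {a} {b} Sa Sb ra≤rb with ch a b Sa Sb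
    ... | inj₁ a⊑b = a⊑b
    ... | inj₂ b⊑a = subst (a ⊑_) (sym (⊑-rank-injective b⊑a (≤-antisym (rank-mono b⊑a) ra≤rb))) (⊑-refl a)

    hasEveryRank⇒maximal : ∀ {S} → IsChain S → HasEveryRank S → IsMaximalChain S
    hasEveryRank⇒maximal {S} ch every = ch , λ T chT S⊆T a Ta →
      let e , Se , re = every (rank a) (rank≤ a)
      in subst (λ x → S x ≡ true) (chain-rank-injective chT (S⊆T e Se) Ta re) Se

    comparable⇒∈maximal : ∀ {S} → IsMaximalChain S → ∀ c →
                          (∀ s → S s ≡ true → (s ⊑ c) ⊎ (c ⊑ s)) → S c ≡ true
    comparable⇒∈maximal {S} (ch , maximal) c comparable = maximal S+c chain+c S⊆S+c c c∈S+c
      where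
      S+c : Tower n → Bool
      S+c x = does (x ≟ c) ∨ S x
      S⊆S+c : ∀ a → S a ≡ true → S+c a ≡ true
      S⊆S+c a Sa with a ≟ c
      ... | yes _ = refl
      ... | no _ = Sa
      c∈S+c : S+c c ≡ true
      c∈S+c with c ≟ c
      ... | yes _ = refl
      ... | no c≢c = ⊥-elim (c≢c refl)
      chain+c : IsChain S+c
      chain+c a b Ta Tb with a ≟ c | b ≟ c
      ... | yes refl | yes refl = inj₁ (⊑-refl a)
      ... | yes refl | no _ = swap (comparable b Tb)
      ... | no _ | yes refl = comparable a Ta
      ... | no _ | no _ = ch a b Ta Tb

    bot∈maximal : ∀ {S} → IsMaximalChain S → S bot ≡ true
    bot∈maximal m = comparable⇒∈maximal m bot (λ _ _ → inj₂ tt)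

    top∈maximal : ∀ {S} → IsMaximalChain S → S top ≡ true
    top∈maximal m = comparable⇒∈maximal m top (λ s _ → inj₁ (⊑top s))

    rankIn? : ∀ S k → Dec (RankIn S k)
    rankIn? S k = any? _ (λ e → (S e Bool.≟ true) ×-dec (rank e ℕ.≟ k))

    private
      narrowˡ : ∀ {x y z d} → y ∸ x ≤ suc d → x < z → z ≤ y → y ∸ z ≤ d
      narrowˡ gap x<z z≤y = ≤-pred (≤-trans (∸-monoʳ-< x<z z≤y) gap)

      narrowʳ : ∀ {x y z d} → y ∸ x ≤ suc d → x ≤ z → z < y → z ∸ x ≤ d
      narrowʳ gap x≤z z<y = ≤-pred (≤-trans (∸-monoˡ-< z<y x≤z) gap)

    -- Induction on a bound d of the gap: an interpolant c of rank k is comparable with every element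
    -- of S (an element strictly between a and b would give a smaller gap around k), so maximality
    -- puts c in S.
    rankIn-interval : ∀ {S} → IsMaximalChain S → ∀ k d {a b} → S a ≡ true → S b ≡ true → a ⊑ b →
                      rank a ≤ k → k ≤ rank b → rank b ∸ rank a ≤ d → RankIn S k
    rankIn-interval {S} m k d {a} {b} Sa Sb a⊑b a≤k k≤b gap with rank a ℕ.≟ k
    ... | yes ra≡k = a , Sa , ra≡k
    ... | no ra≢k with d | rankIn? S k
    ...   | zero | _ = ⊥-elim (ra≢k (≤-antisym a≤k (≤-trans k≤b (m∸n≡0⇒m≤n (n≤0⇒n≡0 gap)))))
    ...   | suc _ | yes found = found
    ...   | suc d | no ¬found with c , a⊑c , c⊑b , rc ← interpolate a⊑b k a≤k k≤b =
      c , comparable⇒∈maximal m c comparable , rc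
      where
      comparable : ∀ s → S s ≡ true → (s ⊑ c) ⊎ (c ⊑ s)
      comparable s Ss with proj₁ m s a Ss Sa | proj₁ m s b Ss Sb
      ... | inj₁ s⊑a | _ = inj₁ (⊑-trans s⊑a a⊑c)
      ... | inj₂ _ | inj₂ b⊑s = inj₂ (⊑-trans c⊑b b⊑s)
      ... | inj₂ a⊑s | inj₁ s⊑b with ≤-total (rank s) k
      ...   | inj₁ rs≤k with rank a ℕ.≟ rank s
      ...     | yes ra≡rs = inj₁ (subst (_⊑ c) (⊑-rank-injective a⊑s ra≡rs) a⊑c)
      ...     | no ra≢rs = ⊥-elim (¬found (rankIn-interval m k d Ss Sb s⊑b rs≤k k≤b
                             (narrowˡ gap (≤∧≢⇒< (rank-mono a⊑s) ra≢rs) (rank-mono s⊑b))))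
      comparable s Ss | inj₂ a⊑s | inj₁ s⊑b | inj₂ k≤rs with rank s ℕ.≟ rank b
      ...     | yes rs≡rb = inj₂ (subst (c ⊑_) (sym (⊑-rank-injective s⊑b rs≡rb)) c⊑b)
      ...     | no rs≢rb = ⊥-elim (¬found (rankIn-interval m k d Sa Ss a⊑s a≤k k≤rs
                             (narrowʳ gap (rank-mono a⊑s) (≤∧≢⇒< (rank-mono s⊑b) rs≢rb))))

    maximal⇒hasEveryRank : ∀ {S} → IsMaximalChain S → HasEveryRank S
    maximal⇒hasEveryRank m k k≤ =
      rankIn-interval m k (rank top) (bot∈maximal m) (top∈maximal m) tt z≤n
                      (subst (k ≤_) (sym (rank-top n)) k≤) ≤-refl

    -- junk value bot when S has no element of rank k
    elementOfRank : (Tower n → Bool) → ℕ → Tower n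
    elementOfRank S k with rankIn? S k
    ... | yes (e , _) = e
    ... | no _ = bot

    elementOfRank-spec : ∀ {S} → IsMaximalChain S → ∀ k → k ≤ n * suc r →
                         S (elementOfRank S k) ≡ true × rank (elementOfRank S k) ≡ k
    elementOfRank-spec {S} m k k≤ with rankIn? S k
    ... | yes (_ , spec) = spec
    ... | no ¬found = ⊥-elim (¬found (maximal⇒hasEveryRank m k k≤))

    elementOfRank-unique : ∀ {S} → IsMaximalChain S → ∀ {a} → S a ≡ true → elementOfRank S (rank a) ≡ a
    elementOfRank-unique m {a} Sa with Se , re ← elementOfRank-spec m (rank a) (rank≤ a) =
      chain-rank-injective (proj₁ m) Se Sa re

  private
    _≤ᵖ_ : ∀ {a b} → Cpow r a → Cpow r b → Set
    _≤ᵖ_ = Pointwise F._≤_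

    ιs-∷ʳ⁺ : ∀ d {a b} (x : Cpow r a) c {z : Cpow r b} → (ιs d x ∷ʳ c) ≤ᵖ z → ιs d (x ∷ʳ c) ≤ᵖ z
    ιs-∷ʳ⁺ zero x c h = h
    ιs-∷ʳ⁺ (suc d) x c (p ∷ ps) = p ∷ ιs-∷ʳ⁺ d x c ps

    ιs-∷ʳ⁻ : ∀ d {a b} (x : Cpow r a) c {z : Cpow r b} → ιs d (x ∷ʳ c) ≤ᵖ z → (ιs d x ∷ʳ c) ≤ᵖ z
    ιs-∷ʳ⁻ zero x c h = h
    ιs-∷ʳ⁻ (suc d) x c (p ∷ ps) = p ∷ ιs-∷ʳ⁻ d x c ps

    ιs[]≤ᵖ : ∀ d {b} (y : Cpow r b) → d + 0 ≡ b → ιs d [] ≤ᵖ y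
    ιs[]≤ᵖ zero [] _ = []
    ιs[]≤ᵖ (suc d) (_ ∷ y) e = z≤n ∷ ιs[]≤ᵖ d y (suc-injective e)

  module _ {n : ℕ} where

    -- _≼_ without the length cast: Pointwise compares vectors of different lengths.
    _≼ʰ_ : Stack r n → Stack r n → Set
    (j , x) ≼ʰ (k , y) = Σ[ d ∈ ℕ ] (d + toℕ j ≡ toℕ k × ιs d x ≤ᵖ y)

    ≼⇒≼ʰ : ∀ {s s'} → s ≼ s' → s ≼ʰ s'
    ≼⇒≼ʰ (d , e , h) = d , e , uncast e h
      where
      uncast : ∀ {a b} (e : a ≡ b) {x : Cpow r a} {y : Cpow r b} → Pointwise F._≤_ (subst (Cpow r) e x) y → x ≤ᵖ y
      uncast refl h = h

    ≼ʰ⇒≼ : ∀ {s s'} → s ≼ʰ s' → s ≼ s'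
    ≼ʰ⇒≼ (d , e , h) = d , e , cast e h
      where
      cast : ∀ {a b} (e : a ≡ b) {x : Cpow r a} {y : Cpow r b} → x ≤ᵖ y → Pointwise F._≤_ (subst (Cpow r) e x) y
      cast refl h = h

  extend : ∀ {n} → Stack r n → Fin (suc r) → Stack r (suc n)
  extend (j , x) c = F.suc j , x ∷ʳ c

  extend-≼ʰ⁺ : ∀ {n} {s s' : Stack r n} {c c'} → s ≼ʰ s' → c F.≤ c' → extend s c ≼ʰ extend s' c'
  extend-≼ʰ⁺ {s = j , x} {k , y} {c} (d , e , h) c≤c' =
    d , trans (+-suc d (toℕ j)) (cong suc e) , ιs-∷ʳ⁺ d x c (Pointwise-∷ʳ⁺ h c≤c')

  extend-≼ʰ⁻ : ∀ {n} {s s' : Stack r n} {c c'} → extend s c ≼ʰ extend s' c' → s ≼ʰ s' × c F.≤ c'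
  extend-≼ʰ⁻ {s = j , x} {k , y} {c} {c'} (d , e , h)
    with h' , c≤c' ← Pointwise-∷ʳ⁻ (ιs d x) y (ιs-∷ʳ⁻ d x c h) =
    (d , suc-injective (trans (sym (+-suc d (toℕ j))) e) , h') , c≤c'

  toStack : ∀ {n} → Tower n → Stack r n
  toStack bot = F.zero , []
  toStack (q ▸ c) = extend (toStack q) c

  fromStack : ∀ {n} → Stack r n → Tower n
  fromStack (F.zero , []) = bot
  fromStack {suc n} (F.suc j , x) = fromStack (j , init x) ▸ last x

  fromStack∘toStack : ∀ {n} (a : Tower n) → fromStack (toStack a) ≡ a
  fromStack∘toStack bot = refl
  fromStack∘toStack (q ▸ c) with j , x ← toStack q in eq
    rewrite init-∷ʳ c x | last-∷ʳ c x = cong (_▸ c) (trans (cong fromStack (sym eq)) (fromStack∘toStack q))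

  toStack∘fromStack : ∀ {n} (s : Stack r n) → toStack (fromStack s) ≡ s
  toStack∘fromStack (F.zero , []) = refl
  toStack∘fromStack {suc n} (F.suc j , x) =
    trans (cong (λ s → extend s (last x)) (toStack∘fromStack (j , init x)))
          (cong (F.suc j ,_) (sym (proj₂ (proj₂ (initLast x)))))

  ⊑⇒≼ʰ : ∀ {n} {a b : Tower n} → a ⊑ b → toStack a ≼ʰ toStack b
  ⊑⇒≼ʰ {a = bot} {b} _ with k , y ← toStack b =
    toℕ k , +-identityʳ (toℕ k) , ιs[]≤ᵖ (toℕ k) y (+-identityʳ (toℕ k))
  ⊑⇒≼ʰ {a = q ▸ c} {q' ▸ c'} (q⊑q' , c≤c') = extend-≼ʰ⁺ (⊑⇒≼ʰ q⊑q') c≤c'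

  ≼ʰ⇒⊑ : ∀ {n} {a b : Tower n} → toStack a ≼ʰ toStack b → a ⊑ b
  ≼ʰ⇒⊑ {a = bot} _ = tt
  ≼ʰ⇒⊑ {a = q ▸ c} {bot} (d , e , _) with toStack q
  ... | j , _ with () ← trans (sym e) (+-suc d (toℕ j))
  ≼ʰ⇒⊑ {a = q ▸ c} {q' ▸ c'} h with q≼q' , c≤c' ← extend-≼ʰ⁻ {s = toStack q} {toStack q'} h =
    ≼ʰ⇒⊑ q≼q' , c≤c'

  maxChains↔towerChains : ∀ n → Inverse (MaxChains r n) (ChainsOf.MaximalChains (_⊑_ {n}))
  maxChains↔towerChains n = maximalChains↔ toStack fromStack fromStack∘toStack toStack∘fromStack
    (λ h → ≼ʰ⇒⊑ (≼⇒≼ʰ h))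
    (λ {s} {s'} h → subst₂ _≼_ (toStack∘fromStack s) (toStack∘fromStack s') (≼ʰ⇒≼ (⊑⇒≼ʰ h)))

module Shuffle (r : ℕ) where
  open Tower r

  lastCoord : ∀ {n} → Tower (suc n) → Fin (suc r)
  lastCoord bot = F.zero
  lastCoord (_ ▸ c) = c

  below : ∀ {n} → Tower (suc n) → Tower n
  below bot = bot
  below (q ▸ _) = q

  ▸-view : ∀ {n t} (a : Tower (suc n)) → rank a ≡ suc t →
           a ≡ below a ▸ lastCoord a × toℕ (lastCoord a) + rank (below a) ≡ t
  ▸-view (q ▸ c) e = refl , suc-injective e

  private
    second-≤ : ∀ c q c' q' → c + q ≤ c' + q' → c' ≤ c + ((c' + q') ∸ (c + q)) → q ≤ q'
    second-≤ c q c' q' t≤t' c'≤ = +-cancelˡ-≤ c' q q' (begin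
      c' + q             ≤⟨ +-monoˡ-≤ q c'≤ ⟩
      c + d + q          ≡⟨ xy∙z≈xz∙y c d q ⟩
      c + q + d          ≡⟨ m+[n∸m]≡n t≤t' ⟩
      c' + q'            ∎)
      where
      open ≤-Reasoning
      d : ℕ
      d = (c' + q') ∸ (c + q)

    unshuffled-≤ : ∀ r L t c → t ≤ r + L → r ≤ c + ((r + L) ∸ t) → t ∸ c ≤ L
    unshuffled-≤ r L t c t≤ r≤ = m≤n+o⇒m∸n≤o t c (+-cancelˡ-≤ r t (c + L) (begin
      r + t                ≤⟨ +-monoˡ-≤ t r≤ ⟩
      c + u + t            ≡⟨ +-assoc c u t ⟩
      c + (u + t)          ≡⟨ cong (c +_) (m∸n+n≡m t≤) ⟩
      c + (r + L)          ≡⟨ x∙yz≈y∙xz c r L ⟩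
      r + (c + L)          ∎))
      where
      open ≤-Reasoning
      u : ℕ
      u = (r + L) ∸ t

  module Compose {n : ℕ} (v : Subset (r + n * suc r)) (P : Tower n → Bool) where

    -- q ▸ c has rank t + 1 for t = c + rank q; it is kept iff q ∈ P and exactly c of the first t
    -- steps of the shuffle v raise the last coordinate.
    compose : Tower (suc n) → Bool
    compose bot = true
    compose (q ▸ c) = P q ∧ (prefixCount v (toℕ c + rank q) ≡ᵇ toℕ c)

    compose-▸⁻ : ∀ {q c} → compose (q ▸ c) ≡ true → P q ≡ true × prefixCount v (toℕ c + rank q) ≡ toℕ c
    compose-▸⁻ e with Pq , eq ← ∧-true⁻ e = Pq , ≡ᵇ⇒≡ _ _ (Equivalence.from T-≡ eq)

    compose-▸⁺ : ∀ {q c} → P q ≡ true → prefixCount v (toℕ c + rank q) ≡ toℕ c → compose (q ▸ c) ≡ true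
    compose-▸⁺ Pq e rewrite Pq = Equivalence.to T-≡ (≡⇒≡ᵇ _ _ e)

    unshuffled : ℕ → ℕ
    unshuffled t = t ∸ prefixCount v t

    unshuffled-step : ∀ t → t < r + n * suc r → unshuffled (suc t) ≤ suc (unshuffled t)
    unshuffled-step t _ = ≤-trans (∸-monoʳ-≤ (suc t) (proj₁ (prefixCount-step v t)))
                                  (≤-reflexive (+-∸-assoc 1 (prefixCount≤ v t)))

    unshuffled-top : ∣ v ∣ ≡ r → unshuffled (r + n * suc r) ≡ n * suc r
    unshuffled-top ∣v∣≡r = trans (cong (r + n * suc r ∸_) (trans (prefixCount-full v) ∣v∣≡r)) (m+n∸m≡n r (n * suc r))

    compose-above : ∣ v ∣ ≡ r → ∀ {q} → P q ≡ true → Σ[ c ∈ Fin (suc r) ] compose (q ▸ c) ≡ true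
    compose-above ∣v∣≡r {q} Pq
      with t , _ , unshuffled≡ ← intermediate-value _ unshuffled refl unshuffled-step (rank q)
                                   (subst (rank q ≤_) (sym (unshuffled-top ∣v∣≡r)) (rank≤ q)) =
      d , compose-▸⁺ Pq pc≡d
      where
      d : Fin (suc r)
      d = fromℕ< (s≤s (subst (prefixCount v t ≤_) ∣v∣≡r (prefixCount≤∣v∣ v t)))
      toℕd : toℕ d ≡ prefixCount v t
      toℕd = F.toℕ-fromℕ< _
      pc≡d : prefixCount v (toℕ d + rank q) ≡ toℕ d
      pc≡d = trans (cong (prefixCount v) (trans (cong₂ _+_ toℕd (sym unshuffled≡)) (m+[n∸m]≡n (prefixCount≤ v t))))
                   (sym toℕd)

    module _ (P-maximal : IsMaximalChain P) (∣v∣≡r : ∣ v ∣ ≡ r) where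

      compose-⊑ : ∀ {q c q' c'} → compose (q ▸ c) ≡ true → compose (q' ▸ c') ≡ true →
                  toℕ c + rank q ≤ toℕ c' + rank q' → q ▸ c ⊑ q' ▸ c'
      compose-⊑ {q} {c} {q'} {c'} h h' t≤t' with Pq , pc≡c ← compose-▸⁻ h | Pq' , pc≡c' ← compose-▸⁻ h' =
        chain-rank-≤⇒⊑ (proj₁ P-maximal) Pq Pq' (second-≤ (toℕ c) (rank q) (toℕ c') (rank q') t≤t' c'≤) , c≤c'
        where
        c≤c' : toℕ c ≤ toℕ c'
        c≤c' = subst₂ _≤_ pc≡c pc≡c' (prefixCount-mono v t≤t')
        c'≤ : toℕ c' ≤ toℕ c + ((toℕ c' + rank q') ∸ (toℕ c + rank q))
        c'≤ = subst₂ (λ a b → a ≤ b + ((toℕ c' + rank q') ∸ (toℕ c + rank q))) pc≡c' pc≡c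
                     (prefixCount-lipschitz v t≤t')

      compose-chain : IsChain compose
      compose-chain bot _ _ _ = inj₁ tt
      compose-chain (_ ▸ _) bot _ _ = inj₂ tt
      compose-chain (q ▸ c) (q' ▸ c') h h' with ≤-total (toℕ c + rank q) (toℕ c' + rank q')
      ... | inj₁ t≤t' = inj₁ (compose-⊑ h h' t≤t')
      ... | inj₂ t'≤t = inj₂ (compose-⊑ h' h t'≤t)

      compose-rank : ∀ t → t ≤ r + n * suc r →
                     Σ[ a ∈ Tower (suc n) ] (compose a ≡ true × rank a ≡ suc t × toℕ (lastCoord a) ≡ prefixCount v t)
      compose-rank t t≤ = q ▸ d , compose-▸⁺ Pq pc≡d , cong suc d+rq≡t , toℕd
        where
        c : ℕ
        c = prefixCount v t
        c≤r : c ≤ r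
        c≤r = subst (c ≤_) ∣v∣≡r (prefixCount≤∣v∣ v t)
        i : ℕ
        i = t ∸ c
        i≤ : i ≤ n * suc r
        i≤ = unshuffled-≤ r (n * suc r) t c t≤
               (subst (_≤ c + ((r + n * suc r) ∸ t)) ∣v∣≡r (∣v∣≤prefixCount+rest v t))
        q : Tower n
        q = elementOfRank P i
        Pq : P q ≡ true
        Pq = proj₁ (elementOfRank-spec P-maximal i i≤)
        d : Fin (suc r)
        d = fromℕ< (s≤s c≤r)
        toℕd : toℕ d ≡ c
        toℕd = F.toℕ-fromℕ< _
        d+rq≡t : toℕ d + rank q ≡ t
        d+rq≡t = trans (cong₂ _+_ toℕd (proj₂ (elementOfRank-spec P-maximal i i≤))) (m+[n∸m]≡n (prefixCount≤ v t))
        pc≡d : prefixCount v (toℕ d + rank q) ≡ toℕ d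
        pc≡d = trans (cong (prefixCount v) d+rq≡t) (sym toℕd)

      compose-maximal : IsMaximalChain compose
      compose-maximal = hasEveryRank⇒maximal compose-chain every
        where
        every : HasEveryRank compose
        every zero _ = bot , refl , refl
        every (suc t) (s≤s t≤) with a , ca , ra , _ ← compose-rank t t≤ = a , ca , ra

  module Decompose {n : ℕ} (S : Tower (suc n) → Bool) (S-maximal : IsMaximalChain S) where

    N : ℕ
    N = r + n * suc r

    e : ℕ → Tower (suc n)
    e = elementOfRank S

    e-spec : ∀ k → k ≤ suc N → S (e k) ≡ true × rank (e k) ≡ k
    e-spec = elementOfRank-spec S-maximal

    lastAt belowRank : ℕ → ℕ
    lastAt t = toℕ (lastCoord (e (suc t)))
    belowRank t = rank (below (e (suc t)))

    unit-step : ∀ {a b : Tower (suc n)} {t} → S a ≡ true → S b ≡ true → rank a ≡ suc t → rank b ≡ suc (suc t) →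
                ((toℕ (lastCoord b) ≡ toℕ (lastCoord a)) ⊎ (toℕ (lastCoord b) ≡ suc (toℕ (lastCoord a)))) ×
                rank (below b) ≤ suc (rank (below a))
    unit-step {q ▸ c} {q' ▸ c'} Sa Sb ra rb with proj₁ S-maximal (q ▸ c) (q' ▸ c') Sa Sb
    ... | inj₁ (q⊑q' , c≤c') = c'≡c⊎1+c , rq'≤
      where
      sum≡ : toℕ c' + rank q' ≡ suc (toℕ c + rank q)
      sum≡ = trans (suc-injective rb) (cong suc (sym (suc-injective ra)))
      c'≤1+c : toℕ c' ≤ suc (toℕ c)
      c'≤1+c = +-cancelʳ-≤ (rank q) (toℕ c') (suc (toℕ c))
                 (≤-trans (+-monoʳ-≤ (toℕ c') (rank-mono q⊑q')) (≤-reflexive sum≡))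
      rq'≤ : rank q' ≤ suc (rank q)
      rq'≤ = +-cancelˡ-≤ (toℕ c) (rank q') (suc (rank q))
               (≤-trans (+-monoˡ-≤ (rank q') c≤c') (≤-reflexive (trans sum≡ (sym (+-suc (toℕ c) (rank q))))))
      c'≡c⊎1+c : (toℕ c' ≡ toℕ c) ⊎ (toℕ c' ≡ suc (toℕ c))
      c'≡c⊎1+c with m≤n⇒m<n∨m≡n c'≤1+c
      ... | inj₂ c'≡1+c = inj₂ c'≡1+c
      ... | inj₁ c'<1+c = inj₁ (≤-antisym (≤-pred c'<1+c) c≤c')
    ... | inj₂ b⊑a = ⊥-elim (<⇒≱ (subst₂ _<_ (sym ra) (sym rb) ≤-refl) (rank-mono b⊑a))

    step : ∀ t → t < N → ((lastAt (suc t) ≡ lastAt t) ⊎ (lastAt (suc t) ≡ suc (lastAt t))) ×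
                         belowRank (suc t) ≤ suc (belowRank t)
    step t t<N with Sa , ra ← e-spec (suc t) (s≤s (<⇒≤ t<N)) | Sb , rb ← e-spec (suc (suc t)) (s≤s t<N) =
      unit-step Sa Sb ra rb

    lastAt0≡0 : lastAt 0 ≡ 0
    lastAt0≡0 = m+n≡0⇒m≡0 _ (proj₂ (▸-view (e 1) (proj₂ (e-spec 1 (s≤s z≤n)))))

    belowRank0≡0 : belowRank 0 ≡ 0
    belowRank0≡0 = m+n≡0⇒n≡0 (lastAt 0) (proj₂ (▸-view (e 1) (proj₂ (e-spec 1 (s≤s z≤n)))))

    e-top : e (suc N) ≡ top
    e-top = subst (λ k → e k ≡ top) (rank-top (suc n)) (elementOfRank-unique S-maximal (top∈maximal S-maximal))

    lastAt-top : lastAt N ≡ r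
    lastAt-top = trans (cong (λ a → toℕ (lastCoord a)) e-top) (F.toℕ-fromℕ r)

    belowRank-top : belowRank N ≡ n * suc r
    belowRank-top = trans (cong (λ a → rank (below a)) e-top) (rank-top n)

    shuffle : Subset N
    shuffle = increments lastAt N

    prefixCount-shuffle : ∀ t → t ≤ N → prefixCount shuffle t ≡ lastAt t
    prefixCount-shuffle t t≤N = begin
      prefixCount shuffle t              ≡⟨ +-identityʳ _ ⟨
      prefixCount shuffle t + 0          ≡⟨ cong (prefixCount shuffle t +_) lastAt0≡0 ⟨
      prefixCount shuffle t + lastAt 0   ≡⟨ prefixCount-increments N lastAt (λ t t<N → proj₁ (step t t<N)) t t≤N ⟩
      lastAt t                           ∎
      where open ≡-Reasoning

    ∣shuffle∣≡r : ∣ shuffle ∣ ≡ r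
    ∣shuffle∣≡r = trans (sym (prefixCount-full shuffle)) (trans (prefixCount-shuffle N ≤-refl) lastAt-top)

    above? : ∀ q → Dec (Σ[ c ∈ Fin (suc r) ] S (q ▸ c) ≡ true)
    above? q = F.any? (λ c → S (q ▸ c) Bool.≟ true)

    projection : Tower n → Bool
    projection q = isYes (above? q)

    projection⁺ : ∀ {q} c → S (q ▸ c) ≡ true → projection q ≡ true
    projection⁺ {q} c Sqc = Equivalence.to T-≡ (fromWitness {a? = above? q} (c , Sqc))

    projection⁻ : ∀ {q} → projection q ≡ true → Σ[ c ∈ Fin (suc r) ] S (q ▸ c) ≡ true
    projection⁻ {q} h = toWitness {a? = above? q} (Equivalence.from T-≡ h)

    projection-chain : IsChain projection
    projection-chain q q' Pq Pq' with c , Sqc ← projection⁻ Pq | c' , Sqc' ← projection⁻ Pq'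
      with proj₁ S-maximal (q ▸ c) (q' ▸ c') Sqc Sqc'
    ... | inj₁ (q⊑q' , _) = inj₁ q⊑q'
    ... | inj₂ (q'⊑q , _) = inj₂ q'⊑q

    below▸lastCoord-∈ : ∀ t → t ≤ N → S (below (e (suc t)) ▸ lastCoord (e (suc t))) ≡ true
    below▸lastCoord-∈ t t≤N with Se , re ← e-spec (suc t) (s≤s t≤N) =
      subst (λ a → S a ≡ true) (proj₁ (▸-view (e (suc t)) re)) Se

    projection-maximal : IsMaximalChain projection
    projection-maximal = hasEveryRank⇒maximal projection-chain every
      where
      every : HasEveryRank projection
      every i i≤ with t , t≤N , rt ← intermediate-value N belowRank belowRank0≡0 (λ t t<N → proj₂ (step t t<N)) i
                                       (subst (i ≤_) (sym belowRank-top) i≤) =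
        below (e (suc t)) , projection⁺ _ (below▸lastCoord-∈ t t≤N) , rt

    open Compose shuffle projection

    recompose : ∀ x → compose x ≡ S x
    recompose bot = sym (bot∈maximal S-maximal)
    recompose (q ▸ c) = Bool-ext composed⇒S S⇒composed
      where
      t : ℕ
      t = toℕ c + rank q
      t≤N : t ≤ N
      t≤N = +-mono-≤ (F.toℕ≤pred[n] c) (rank≤ q)
      S⇒composed : S (q ▸ c) ≡ true → compose (q ▸ c) ≡ true
      S⇒composed Sqc = compose-▸⁺ (projection⁺ c Sqc)
        (trans (prefixCount-shuffle t t≤N) (cong (λ a → toℕ (lastCoord a)) (elementOfRank-unique S-maximal Sqc)))
      composed⇒S : compose (q ▸ c) ≡ true → S (q ▸ c) ≡ true
      composed⇒S h with Pq , pc≡c ← compose-▸⁻ h | Sa , ra ← e-spec (suc t) (s≤s t≤N) =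
        subst (λ x → S x ≡ true) a≡q▸c Sa
        where
        a : Tower (suc n)
        a = e (suc t)
        lastCoord≡c : lastCoord a ≡ c
        lastCoord≡c = F.toℕ-injective (trans (sym (prefixCount-shuffle t t≤N)) pc≡c)
        rank-below≡ : rank (below a) ≡ rank q
        rank-below≡ = +-cancelˡ-≡ (toℕ c) _ _
          (trans (cong (λ d → toℕ d + rank (below a)) (sym lastCoord≡c)) (proj₂ (▸-view a ra)))
        below≡q : below a ≡ q
        below≡q = chain-rank-injective projection-chain (projection⁺ (lastCoord a) (below▸lastCoord-∈ t t≤N)) Pq rank-below≡
        a≡q▸c : a ≡ q ▸ c
        a≡q▸c = trans (proj₁ (▸-view a ra)) (cong₂ _▸_ below≡q lastCoord≡c)

  module _ {n : ℕ} (v : Subset (r + n * suc r)) (∣v∣≡r : ∣ v ∣ ≡ r)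
           (P : Tower n → Bool) (P-maximal : IsMaximalChain P) where
    open Compose v P
    private
      module D = Decompose compose (compose-maximal P-maximal ∣v∣≡r)

    shuffle-compose : D.shuffle ≡ v
    shuffle-compose = trans (increments-cong D.N lastAt≡) (increments-prefixCount v)
      where
      lastAt≡ : ∀ t → t ≤ D.N → D.lastAt t ≡ prefixCount v t
      lastAt≡ t t≤ with a , ca , ra , lastCoord≡ ← compose-rank P-maximal ∣v∣≡r t t≤ =
        trans (cong (λ x → toℕ (lastCoord x)) (subst (λ k → elementOfRank compose k ≡ a) ra
                                                 (elementOfRank-unique (compose-maximal P-maximal ∣v∣≡r) ca)))
              lastCoord≡

    projection-compose : ∀ q → D.projection q ≡ P q
    projection-compose q = Bool-ext projected⇒P P⇒projected
      where
      projected⇒P : D.projection q ≡ true → P q ≡ true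
      projected⇒P h with c , h' ← D.projection⁻ h = proj₁ (compose-▸⁻ {q} {c} h')
      P⇒projected : P q ≡ true → D.projection q ≡ true
      P⇒projected Pq with c , h ← compose-above ∣v∣≡r Pq = D.projection⁺ c h

  compose-cong : ∀ {n} {v v' : Subset (r + n * suc r)} {P P' : Tower n → Bool} → v ≡ v' → (∀ q → P q ≡ P' q) →
                 ∀ x → Compose.compose v P x ≡ Compose.compose v' P' x
  compose-cong refl P≗P' bot = refl
  compose-cong refl P≗P' (q ▸ c) = cong (_∧ _) (P≗P' q)

  module _ {n : ℕ} {S S' : Tower (suc n) → Bool} (S-maximal : IsMaximalChain S) (S'-maximal : IsMaximalChain S')
           (S≗S' : ∀ x → S x ≡ S' x) where
    private
      module D = Decompose S S-maximal
      module D' = Decompose S' S'-maximal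

    shuffle-cong : D.shuffle ≡ D'.shuffle
    shuffle-cong = increments-cong D.N lastAt≡
      where
      lastAt≡ : ∀ t → t ≤ D.N → D.lastAt t ≡ D'.lastAt t
      lastAt≡ t t≤ with Se , re ← D.e-spec (suc t) (s≤s t≤) =
        cong (λ a → toℕ (lastCoord a))
             (sym (subst (λ k → D'.e k ≡ D.e (suc t)) re (elementOfRank-unique S'-maximal (trans (sym (S≗S' _)) Se))))

    projection-cong : ∀ q → D.projection q ≡ D'.projection q
    projection-cong q = Bool-ext (λ h → let c , Sqc = D.projection⁻ h in D'.projection⁺ c (trans (sym (S≗S' _)) Sqc))
                                 (λ h → let c , S'qc = D'.projection⁻ h in D.projection⁺ c (trans (S≗S' _) S'qc))

  MaximalTowerChains : ℕ → Setoid 0ℓ 0ℓ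
  MaximalTowerChains n = ChainsOf.MaximalChains (_⊑_ {n})

  maximalTowerChains-base : Inverse (MaximalTowerChains 0) (setoid (Fin 1))
  maximalTowerChains-base = mkInverse (λ _ → F.zero) (λ _ → (λ _ → true) , everything-maximal)
    (λ _ → refl) (λ _ _ → refl) (λ { F.zero → refl }) (λ { (S , S-maximal) bot → sym (bot∈maximal S-maximal) })
    where
    everything-maximal : IsMaximalChain {0} (λ _ → true)
    everything-maximal = hasEveryRank⇒maximal (λ { bot bot _ _ → inj₁ tt }) (λ { zero _ → bot , refl , refl ; (suc _) () })

  maximalTowerChains-step : ∀ n → Inverse (MaximalTowerChains (suc n)) (SubsetsOfSize (r + n * suc r) r ×ₛ MaximalTowerChains n)
  maximalTowerChains-step n = mkInverse
    (λ (S , S-maximal) → let open Decompose S S-maximal in (shuffle , ∣shuffle∣≡r) , (projection , projection-maximal))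
    (λ ((v , ∣v∣≡r) , (P , P-maximal)) → Compose.compose v P , Compose.compose-maximal v P P-maximal ∣v∣≡r)
    (λ {(S , S-maximal)} {(S' , S'-maximal)} S≗S' →
       shuffle-cong S-maximal S'-maximal S≗S' , projection-cong S-maximal S'-maximal S≗S')
    (λ (v≡v' , P≗P') → compose-cong v≡v' P≗P')
    (λ ((v , ∣v∣≡r) , (P , P-maximal)) →
       shuffle-compose v ∣v∣≡r P P-maximal , projection-compose v ∣v∣≡r P P-maximal)
    (λ (S , S-maximal) → Decompose.recompose S S-maximal)

module Partition (r : ℕ) where

  m : ℕ
  m = suc r

  infix 4 _≟ˢ_

  _≟ˢ_ : ∀ {L} (B B' : Subset L) → Dec (B ≡ B')
  _≟ˢ_ = ≡-dec Bool._≟_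

  IsBlockOf : ∀ {L} → (Subset L → Bool) → Fin L → Subset L → Set
  IsBlockOf P i B = P B ≡ true × i ∈ B × (∀ B' → P B' ≡ true → i ∈ B' → B' ≡ B)

  module Blocks {L : ℕ} {P : Subset L → Bool} (P-partition : IsMPartition m L P) where

    blockOf : Fin L → Subset L
    blockOf i = proj₁ (proj₂ P-partition i)

    blockOf-∈P : ∀ i → P (blockOf i) ≡ true
    blockOf-∈P i = proj₁ (proj₂ (proj₂ P-partition i))

    ∈blockOf : ∀ i → i ∈ blockOf i
    ∈blockOf i = proj₁ (proj₂ (proj₂ (proj₂ P-partition i)))

    blockOf-unique : ∀ i B → P B ≡ true → i ∈ B → B ≡ blockOf i
    blockOf-unique i = proj₂ (proj₂ (proj₂ (proj₂ P-partition i)))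

    same-block : ∀ {B B'} i → P B ≡ true → P B' ≡ true → i ∈ B → i ∈ B' → B ≡ B'
    same-block {B} {B'} i PB PB' i∈B i∈B' = trans (blockOf-unique i B PB i∈B) (sym (blockOf-unique i B' PB' i∈B'))

  module SplitOffZero {L : ℕ} (P : Subset (suc L) → Bool) (P-partition : IsMPartition m (suc L) P) where
    open Blocks P-partition

    partners : Subset L
    partners = tail (blockOf F.zero)

    blockOf0≡ : blockOf F.zero ≡ true ∷ partners
    blockOf0≡ with true ∷ _ ← blockOf F.zero | here ← ∈blockOf F.zero = refl

    P-partners : P (true ∷ partners) ≡ true
    P-partners = subst (λ B → P B ≡ true) blockOf0≡ (blockOf-∈P F.zero)

    ∣partners∣≡r : ∣ partners ∣ ≡ r
    ∣partners∣≡r = suc-injective (trans (cong ∣_∣ (sym blockOf0≡)) (proj₁ P-partition _ (blockOf-∈P F.zero)))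

    P-true∷⇒ : ∀ {B} → P (true ∷ B) ≡ true → B ≡ partners
    P-true∷⇒ PB = cong tail (same-block F.zero PB P-partners here here)

    P-false∷⇒disjoint : ∀ {B} → P (false ∷ B) ≡ true → partners ∩ B ≡ ∅
    P-false∷⇒disjoint {B} PB = disjoint⁺ partners B λ p∈partners p∈B →
      case same-block (F.suc _) PB P-partners (there p∈B) (there p∈partners) of λ ()

    rest : Subset ∣ ∁ partners ∣ → Bool
    rest C = P (false ∷ spread partners C)

    rest-partition : IsMPartition m ∣ ∁ partners ∣ rest
    rest-partition = sizes , covering
      where
      sizes : ∀ C → rest C ≡ true → ∣ C ∣ ≡ m
      sizes C restC = trans (sym (∣spread∣ partners C)) (proj₁ P-partition _ restC)
      covering : ∀ i → ∃[ B ] IsBlockOf rest i B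
      covering i with blockOf (F.suc (hole partners i)) | blockOf-∈P (F.suc (hole partners i)) | ∈blockOf (F.suc (hole partners i))
      ... | true ∷ B | PB | there j∈B = ⊥-elim (hole∉ partners i (subst (hole partners i ∈_) (P-true∷⇒ PB) j∈B))
      ... | false ∷ B | PB | there j∈B = restrict partners B , restC , hole∈⇒∈restrict partners j∈B , unique
        where
        disjoint : partners ∩ B ≡ ∅
        disjoint = P-false∷⇒disjoint PB
        restC : rest (restrict partners B) ≡ true
        restC = subst (λ B → P (false ∷ B) ≡ true) (sym (spread-restrict partners B disjoint)) PB
        unique : ∀ C' → rest C' ≡ true → i ∈ C' → C' ≡ restrict partners B
        unique C' restC' i∈C' = trans (sym (restrict-spread partners C'))
          (cong (restrict partners) (cong tail (same-block (F.suc (hole partners i)) restC' PB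
                                                          (there (hole∈spread partners i∈C')) (there j∈B))))

  module _ {L : ℕ} (v : Subset L) where

    -- the partition whose block of 0 is {0} ∪ v and whose other blocks are those of Q, spread over ∁ v
    attach : (Subset ∣ ∁ v ∣ → Bool) → Subset (suc L) → Bool
    attach Q (true ∷ B) = does (B ≟ˢ v)
    attach Q (false ∷ B) = does (v ∩ B ≟ˢ ∅) ∧ Q (restrict v B)

    attach-true∷ : ∀ {Q B} → attach Q (true ∷ B) ≡ true → B ≡ v
    attach-true∷ {B = B} = does-true (B ≟ˢ v)

    attach-false∷ : ∀ {Q B} → attach Q (false ∷ B) ≡ true → v ∩ B ≡ ∅ × Q (restrict v B) ≡ true
    attach-false∷ {B = B} h with v ∩ B ≟ˢ ∅ | h
    ... | yes disjoint | QB = disjoint , QB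

    attach-v : ∀ {Q} → attach Q (true ∷ v) ≡ true
    attach-v = dec-true (v ≟ˢ v) refl

    attach-spread : ∀ Q C → attach Q (false ∷ spread v C) ≡ Q C
    attach-spread Q C rewrite dec-true (v ∩ spread v C ≟ˢ ∅) (spread-disjoint v C) = cong Q (restrict-spread v C)

    attach-cong : ∀ {Q Q'} → (∀ C → Q C ≡ Q' C) → ∀ B → attach Q B ≡ attach Q' B
    attach-cong Q≗Q' (true ∷ B) = refl
    attach-cong Q≗Q' (false ∷ B) = cong (does (v ∩ B ≟ˢ ∅) ∧_) (Q≗Q' (restrict v B))

    attach-partition : ∣ v ∣ ≡ r → ∀ {Q} → IsMPartition m ∣ ∁ v ∣ Q → IsMPartition m (suc L) (attach Q)
    attach-partition ∣v∣≡r {Q} Q-partition = sizes , covering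
      where
      open Blocks Q-partition
      sizes : ∀ B → attach Q B ≡ true → ∣ B ∣ ≡ m
      sizes (true ∷ B) h = cong suc (trans (cong ∣_∣ (attach-true∷ {Q} {B} h)) ∣v∣≡r)
      sizes (false ∷ B) h with disjoint , QB ← attach-false∷ {Q} h =
        trans (sym (∣restrict∣ v B disjoint)) (proj₁ Q-partition _ QB)
      in-v-unique : ∀ {i} → i ∈ true ∷ v → ∀ B' → attach Q B' ≡ true → i ∈ B' → B' ≡ true ∷ v
      in-v-unique _ (true ∷ B') h _ = cong (true ∷_) (attach-true∷ {Q} h)
      in-v-unique (there p∈v) (false ∷ B') h (there p∈B') = ⊥-elim (disjoint⁻ (proj₁ (attach-false∷ {Q} h)) p∈v p∈B')
      in-v-block : ∀ {i} → i ∈ true ∷ v → ∃[ B ] IsBlockOf (attach Q) i B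
      in-v-block i∈ = true ∷ v , attach-v {Q} , i∈ , in-v-unique i∈
      covering : ∀ i → ∃[ B ] IsBlockOf (attach Q) i B
      covering F.zero = in-v-block here
      covering (F.suc p) with ∈⊎hole v p
      ... | inj₁ p∈v = in-v-block (there p∈v)
      ... | inj₂ (i , refl) = false ∷ spread v (blockOf i) , trans (attach-spread Q _) (blockOf-∈P i) ,
                              there (hole∈spread v (∈blockOf i)) , unique
        where
        unique : ∀ B' → attach Q B' ≡ true → F.suc (hole v i) ∈ B' → B' ≡ false ∷ spread v (blockOf i)
        unique (true ∷ B') h (there j∈B') = ⊥-elim (hole∉ v i (subst (hole v i ∈_) (attach-true∷ {Q} h) j∈B'))
        unique (false ∷ B') h (there j∈B') with disjoint , QB ← attach-false∷ {Q} h =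
          cong (false ∷_) (trans (sym (spread-restrict v B' disjoint))
                                 (cong (spread v) (same-block i QB (blockOf-∈P i) (hole∈⇒∈restrict v j∈B') (∈blockOf i))))

  attach-split : ∀ {L} (P : Subset (suc L) → Bool) (P-partition : IsMPartition m (suc L) P) →
                 let open SplitOffZero P P-partition in ∀ B → attach partners rest B ≡ P B
  attach-split P P-partition (true ∷ B) =
    Bool-ext (λ h → subst (λ x → P (true ∷ x) ≡ true) (sym (attach-true∷ partners {rest} h)) P-partners)
             (λ h → dec-true (B ≟ˢ partners) (P-true∷⇒ h))
    where open SplitOffZero P P-partition
  attach-split P P-partition (false ∷ B) =
    Bool-ext (λ h → let disjoint , restB = attach-false∷ partners {rest} h in
                    subst (λ x → P (false ∷ x) ≡ true) (spread-restrict partners B disjoint) restB)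
             (λ h → let disjoint = P-false∷⇒disjoint h in
                    ∧-true⁺ (dec-true (partners ∩ B ≟ˢ ∅) disjoint)
                            (subst (λ x → P (false ∷ x) ≡ true) (sym (spread-restrict partners B disjoint)) h))
    where open SplitOffZero P P-partition

  transport-partition : ∀ {a b} (e : b ≡ a) {Q : Subset a → Bool} → IsMPartition m a Q →
                        IsMPartition m b (λ C → Q (subst Subset e C))
  transport-partition refl Q-partition = Q-partition

  spread-cong : ∀ {L N} {v v' : Subset L} (v≡v' : v ≡ v') (e : ∣ ∁ v ∣ ≡ N) (e' : ∣ ∁ v' ∣ ≡ N) C →
                spread v (subst Subset (sym e) C) ≡ spread v' (subst Subset (sym e') C)
  spread-cong refl e e' C rewrite ≡-irrelevant e e' = refl

  module _ (N : ℕ) where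
    private
      ∣∁v∣≡N : (v : Subset (r + N)) → ∣ v ∣ ≡ r → ∣ ∁ v ∣ ≡ N
      ∣∁v∣≡N v ∣v∣≡r = trans (∣∁p∣≡n∸∣p∣ v) (trans (cong (r + N ∸_) ∣v∣≡r) (m+n∸m≡n r N))

      S₁ S₂ : Setoid 0ℓ 0ℓ
      S₁ = MPartitions m (suc (r + N))
      S₂ = SubsetsOfSize (r + N) r ×ₛ MPartitions m N

      split : Setoid.Carrier S₁ → Setoid.Carrier S₂
      split (P , P-partition) = (partners , ∣partners∣≡r) ,
                                (λ C → rest (subst Subset (sym e) C)) , transport-partition (sym e) rest-partition
        where
        open SplitOffZero P P-partition
        e : ∣ ∁ partners ∣ ≡ N
        e = ∣∁v∣≡N partners ∣partners∣≡r

      join : Setoid.Carrier S₂ → Setoid.Carrier S₁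
      join ((v , ∣v∣≡r) , (Q , Q-partition)) =
        attach v (λ C → Q (subst Subset (∣∁v∣≡N v ∣v∣≡r) C)) ,
        attach-partition v ∣v∣≡r (transport-partition (∣∁v∣≡N v ∣v∣≡r) Q-partition)

    partitions-step : Inverse S₁ S₂
    partitions-step = mkInverse split join (λ {x} {y} → split-cong {x} {y}) (λ {x} {y} → join-cong {x} {y}) split∘join join∘split
      where
      split-cong : ∀ {x y} → Setoid._≈_ S₁ x y → Setoid._≈_ S₂ (split x) (split y)
      split-cong {P , P-partition} {P' , P'-partition} P≗P' = sym partners'≡partners , λ C →
        trans (P≗P' _) (cong (λ B → P' (false ∷ B))
          (spread-cong (sym partners'≡partners) (∣∁v∣≡N X.partners X.∣partners∣≡r) (∣∁v∣≡N Y.partners Y.∣partners∣≡r) C))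
        where
        module X = SplitOffZero P P-partition
        module Y = SplitOffZero P' P'-partition
        partners'≡partners : Y.partners ≡ X.partners
        partners'≡partners = X.P-true∷⇒ (trans (P≗P' _) Y.P-partners)
      join-cong : ∀ {x y} → Setoid._≈_ S₂ x y → Setoid._≈_ S₁ (join x) (join y)
      join-cong {(v , ∣v∣≡r) , (Q , _)} {(_ , ∣v∣≡r') , (Q' , _)} (refl , Q≗Q') = attach-cong v λ C →
        trans (cong (λ e → Q (subst Subset e C)) (≡-irrelevant (∣∁v∣≡N v ∣v∣≡r) (∣∁v∣≡N v ∣v∣≡r')))
              (Q≗Q' _)
      split∘join : ∀ y → Setoid._≈_ S₂ (split (join y)) y
      split∘join ((v , ∣v∣≡r) , (Q , Q-partition)) = partners≡v , λ C → attach-rest _ partners≡v _ C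
        where
        e : ∣ ∁ v ∣ ≡ N
        e = ∣∁v∣≡N v ∣v∣≡r
        Q′ : Subset ∣ ∁ v ∣ → Bool
        Q′ C = Q (subst Subset e C)
        open SplitOffZero (attach v Q′) (attach-partition v ∣v∣≡r (transport-partition e Q-partition))
        partners≡v : partners ≡ v
        partners≡v = sym (P-true∷⇒ (attach-v v {Q′}))
        attach-rest : ∀ w → w ≡ v → (e′ : ∣ ∁ w ∣ ≡ N) →
                      ∀ C → attach v Q′ (false ∷ spread w (subst Subset (sym e′) C)) ≡ Q C
        attach-rest w refl e′ C rewrite ≡-irrelevant e′ e = trans (attach-spread v Q′ _) (cong Q (subst-subst-sym e))
      join∘split : ∀ x → Setoid._≈_ S₁ (join (split x)) x
      join∘split (P , P-partition) B =
        trans (attach-cong partners (λ C → cong rest (subst-sym-subst (∣∁v∣≡N partners ∣partners∣≡r))) B)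
              (attach-split P P-partition B)
        where open SplitOffZero P P-partition

  mPartitions-base : Inverse (MPartitions (suc r) 0) (setoid (Fin 1))
  mPartitions-base = mkInverse (λ _ → F.zero) (λ _ → (λ _ → false) , (λ _ ()) , (λ ()))
    (λ _ → refl) (λ _ _ → refl) (λ { F.zero → refl }) no-blocks
    where
    no-blocks : ∀ x → ∀ B → false ≡ proj₁ x B
    no-blocks (P , P-partition) [] with P [] in P[]
    ... | false = refl
    ... | true with () ← proj₁ P-partition [] P[]

module _ (r : ℕ) where
  open Tower r using (maxChains↔towerChains)
  open Shuffle r using (MaximalTowerChains; maximalTowerChains-base; maximalTowerChains-step)
  open Partition r using (mPartitions-base; partitions-step)

  maxChains↔ : ∀ n → Inverse (MaxChains r n) (setoid (Fin (binomialProduct r n)))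
  maxChains↔ n = maxChains↔towerChains n
                 ⨾ counted-by-binomialProduct r MaximalTowerChains maximalTowerChains-base maximalTowerChains-step n

  mPartitions↔ : ∀ n → Inverse (MPartitions (suc r) (n * suc r)) (setoid (Fin (binomialProduct r n)))
  mPartitions↔ = counted-by-binomialProduct r (λ n → MPartitions (suc r) (n * suc r)) mPartitions-base
                   (λ n → partitions-step (n * suc r))

MPartitions-cong : ∀ {m a b} → a ≡ b → Inverse (MPartitions m a) (MPartitions m b)
MPartitions-cong refl = ↔ₛ-id _

theorem1p2 : (m : ℕ) → 1 ≤ m → (n : ℕ) →
    Bijection (MaxChains (m ∸ 1) n) (MPartitions m (m * n)) ×
    Bijection (MaxChains (m ∸ 1) n) (setoid (Fin (countMPartitions m n)))
theorem1p2 (suc r) _ n =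
  Inverse⇒Bijection (maxChains↔ r n ⨾ ↔ₛ-sym (mPartitions↔ r n) ⨾ MPartitions-cong (*-comm n (suc r))) ,
  Inverse⇒Bijection (maxChains↔ r n ⨾ Fin-cong (binomialProduct≡countMPartitions r n))
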